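{- Let $2\le r\le 5$, let $A\in\mathcal{A}(2,1,1)$, $B\in\mathcal{B}_r^*(2,1,1)$, and let $f:V(A)\to V(B)$ be a function that preserves colours. Then $A\otimes_f B$ is $3$-connected if and only if $A\in\mathcal{A}_\#(2,1,1)$ and $A$ is $2$-connected.
   Context: All graphs are finite and simple. A graph is $k$-connected if it has more than $k$ vertices and removing fewer than $k$ vertices leaves it connected. A cut-set is a set of vertices whose removal increases the number of components; an $h$-cut is a cut-set of size $h$. For graphs $A,B$ and $f:V(A)\to V(B)$, the Sierpiński product $A\otimes_f B$ has vertex set $V(A)\times V(B)$ and edge set $\{(a,b_1)(a,b_2): b_1b_2\in E(B)\}\cup\{(a_1,f(a_2))(a_2,f(a_1)) : a_1a_2\in E(A)\}$. Colours: $c_1$ (red), $c_2$ (blue), $c_3$ (green). $\mathcal{A}(2,1,1)$: connected planar $4$-regular graphs $A$ with a colouring of the vertices by $c_1,c_2,c_3$ such that every vertex has exactly two red, one blue, and one green neighbour. $\mathcal{A}_\#(2,1,1)$: those $A\in\mathcal{A}(2,1,1)$ such that for every $2$-cut $\{a_1,a_2\}$ of $A$, $A-a_1-a_2$ has exactly two connected components, and for at least one $i\in\{1,2\}$ each of these components contains two neighbours of $a_i$, exactly one of which is red. $\mathcal{B}_r(2,1,1)$: connected planar graphs $B$ with degree sequence $r,\dots,r,r-1,r-1,r-2$, the vertex of degree $r-2$ coloured $c_1$ and the two vertices of degree $r-1$ coloured $c_2$ and $c_3$ respectively (other vertices uncoloured), admitting a planar embedding in which all vertices of degree less than $r$ lie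 on a common region. $\mathcal{B}_r^*(2,1,1)$: those $B\in\mathcal{B}_r(2,1,1)$ such that whenever $W$ is an $h$-cut of $B$ with $h\in\{1,2\}$, every connected component $J$ of $B-W$ satisfies $\sum_{v\in V(J)}(r-\deg_B(v))\ge 3-h$. $f$ preserves colours if it maps each vertex of $A$ to the vertex of $B$ of the same colour. -}

module Defs where

open import Data.Nat using (ℕ; zero; suc; _+_; _*_; _∸_; _<_; _≤_; _<ᵇ_)
open import Data.Bool using (Bool; true; false; _∧_; _∨_; not; if_then_else_)
open import Data.Fin using (Fin; toℕ; remQuot)
open import Data.Fin.Properties using (_≟_)
open import Data.Product using (Σ; ∃; ∃₂; _×_; _,_; proj₁; proj₂)
open import Data.Sum using (_⊎_)
open import Relation.Nullary using (¬_)
open import Relation.Nullary.Decidable using (⌊_⌋)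
open import Relation.Binary.PropositionalEquality using (_≡_; _≢_)

Adj : ℕ → Set
Adj n = Fin n → Fin n → Bool

record IsSimple {n : ℕ} (adj : Adj n) : Set where
  field
    sym    : ∀ u v → adj u v ≡ adj v u
    irrefl : ∀ u → adj u u ≡ false

sumFin : ∀ {n} → (Fin n → ℕ) → ℕ
sumFin {zero}  f = 0
sumFin {suc n} f = f Fin.zero + sumFin (λ i → f (Fin.suc i))

count : ∀ {n} → (Fin n → Bool) → ℕ
count P = sumFin (λ i → if P i then 1 else 0)

deg : ∀ {n} → Adj n → Fin n → ℕ
deg adj v = count (adj v)

numEdges : ∀ {n} → Adj n → ℕ
numEdges adj = sumFin (λ u → count (λ v → adj u v ∧ (toℕ u <ᵇ toℕ v)))

none : ∀ {n} → Fin n → Bool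
none _ = false

pair : ∀ {n} → Fin n → Fin n → Fin n → Bool
pair a b x = ⌊ x ≟ a ⌋ ∨ ⌊ x ≟ b ⌋

-- walks in G - W (W a removed vertex set); intermediate/final vertices avoid W
data Path {n : ℕ} (adj : Adj n) (W : Fin n → Bool) : Fin n → Fin n → Set where
  here : ∀ {u} → Path adj W u u
  step : ∀ {u v w} → adj u v ≡ true → W v ≡ false → Path adj W v w → Path adj W u w

ConnAvoid : ∀ {n} → Adj n → (Fin n → Bool) → Set
ConnAvoid adj W = ∀ u v → W u ≡ false → W v ≡ false → Path adj W u v

Connected : ∀ {n} → Adj n → Set
Connected {n} adj = (0 < n) × ConnAvoid adj none

KConnected : ∀ {n} → ℕ → Adj n → Set
KConnected {n} k adj = (k < n) × (∀ (S : Fin n → Bool) → count S < k → ConnAvoid adj S)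

-- W is a cut-set of the (connected) graph G: G - W is disconnected,
-- i.e. removing W increases the number of components (from 1 to ≥ 2)
IsCut : ∀ {n} → Adj n → (Fin n → Bool) → Set
IsCut adj W = ∃₂ λ u v → W u ≡ false × W v ≡ false × ¬ Path adj W u v

record IsComponent {n : ℕ} (adj : Adj n) (W : Fin n → Bool) (C : Fin n → Bool) : Set where
  field
    nonempty : ∃ λ x → C x ≡ true
    avoids   : ∀ x → C x ≡ true → W x ≡ false
    conn     : ∀ x y → C x ≡ true → C y ≡ true → Path adj W x y
    closed   : ∀ x y → C x ≡ true → W y ≡ false → adj x y ≡ true → C y ≡ true

-- Planar embeddings, combinatorially: a rotation system (cyclic order of
-- neighbours at each vertex) whose faces (orbits of the face-tracing map
-- on darts) satisfy Euler's formula V - E + F = 2 (genus 0).  For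
-- connected graphs with at least one edge this is exactly planarity
-- (Heffter–Edmonds–Ringel), and the faces are the regions of the embedding.

iter : ∀ {A : Set} → (A → A) → ℕ → A → A
iter g zero    x = x
iter g (suc k) x = g (iter g k x)

faceStep : ∀ {n} → (Fin n → Fin n → Fin n) → Fin n × Fin n → Fin n × Fin n
faceStep rot (u , v) = v , rot v u

record PlanarEmbedding {n : ℕ} (adj : Adj n) : Set where
  field
    rot        : Fin n → Fin n → Fin n
    rot-adj    : ∀ u v → adj u v ≡ true → adj u (rot u v) ≡ true
    rot-cyclic : ∀ u v w → adj u v ≡ true → adj u w ≡ true →
                 ∃ λ k → iter (rot u) k v ≡ w
    faces      : ℕ
    face       : Fin n → Fin n → Fin faces
    face-orbit : ∀ u v x y → adj u v ≡ true → adj x y ≡ true →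
                 (face u v ≡ face x y → ∃ λ k → iter (faceStep rot) k (u , v) ≡ (x , y))
                 × ((∃ λ k → iter (faceStep rot) k (u , v) ≡ (x , y)) → face u v ≡ face x y)
    face-surj  : ∀ i → ∃₂ λ u v → adj u v ≡ true × face u v ≡ i
    euler      : n + faces ≡ numEdges adj + 2

data Colour : Set where
  red blue green : Colour

_==c_ : Colour → Colour → Bool
red   ==c red   = true
blue  ==c blue  = true
green ==c green = true
_     ==c _     = false

record ClassA {n : ℕ} (adj : Adj n) (col : Fin n → Colour) : Set where
  field
    simple    : IsSimple adj
    connected : Connected adj
    planar    : PlanarEmbedding adj
    regular   : ∀ v → deg adj v ≡ 4
    redNbrs   : ∀ v → count (λ u → adj v u ∧ (col u ==c red))   ≡ 2
    blueNbrs  : ∀ v → count (λ u → adj v u ∧ (col u ==c blue))  ≡ 1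
    greenNbrs : ∀ v → count (λ u → adj v u ∧ (col u ==c green)) ≡ 1

TwoNbrsOneRed : ∀ {n} → Adj n → (Fin n → Colour) → Fin n → (Fin n → Bool) → Set
TwoNbrsOneRed adj col a C =
  (count (λ u → C u ∧ adj a u) ≡ 2) × (count (λ u → C u ∧ adj a u ∧ (col u ==c red)) ≡ 1)

-- the extra condition of 𝒜_#(2,1,1) (A ∈ 𝒜_# iff ClassA and Sharp)
Sharp : ∀ {n} → Adj n → (Fin n → Colour) → Set
Sharp {n} adj col =
  ∀ a₁ a₂ → a₁ ≢ a₂ → IsCut adj (pair a₁ a₂) →
  Σ (Fin n → Bool) λ C₁ → Σ (Fin n → Bool) λ C₂ →
    IsComponent adj (pair a₁ a₂) C₁ × IsComponent adj (pair a₁ a₂) C₂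
    × (∃ λ x → C₁ x ≡ true × C₂ x ≡ false)
    × (∀ x → pair a₁ a₂ x ≡ false → C₁ x ≡ true ⊎ C₂ x ≡ true)
    × ((TwoNbrsOneRed adj col a₁ C₁ × TwoNbrsOneRed adj col a₁ C₂)
       ⊎ (TwoNbrsOneRed adj col a₂ C₁ × TwoNbrsOneRed adj col a₂ C₂))

-- ℬ_r(2,1,1): vtx c is the vertex of colour c (all others uncoloured)

record ClassB (r : ℕ) {n : ℕ} (adj : Adj n) (vtx : Colour → Fin n) : Set where
  field
    simple     : IsSimple adj
    connected  : Connected adj
    degRed     : deg adj (vtx red)   ≡ r ∸ 2
    degBlue    : deg adj (vtx blue)  ≡ r ∸ 1
    degGreen   : deg adj (vtx green) ≡ r ∸ 1
    blue≢green : vtx blue ≢ vtx green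
    degOther   : ∀ v → (∀ c → v ≢ vtx c) → deg adj v ≡ r
    embedding  : Σ (PlanarEmbedding adj) λ E →
                 ∃ λ (i : Fin (PlanarEmbedding.faces E)) →
                 ∀ v → deg adj v < r →
                 ∃ λ w → adj v w ≡ true × PlanarEmbedding.face E v w ≡ i

record ClassBStar (r : ℕ) {n : ℕ} (adj : Adj n) (vtx : Colour → Fin n) : Set where
  field
    classB : ClassB r adj vtx
    cuts   : ∀ (h : ℕ) (W : Fin n → Bool) → (h ≡ 1 ⊎ h ≡ 2) → count W ≡ h →
             IsCut adj W → ∀ C → IsComponent adj W C →
             3 ∸ h ≤ sumFin (λ v → if C v then r ∸ deg adj v else 0)

-- Sierpiński product A ⊗_f B on V(A) × V(B), encoded as Fin (nA * nB)
-- via remQuot (vertex x ↦ (a , b)).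

sierpinski : ∀ {nA nB} → Adj nA → Adj nB → (Fin nA → Fin nB) → Adj (nA * nB)
sierpinski {nA} {nB} adjA adjB f x y =
  let a₁ = proj₁ (remQuot {nA} nB x) ; b₁ = proj₂ (remQuot {nA} nB x)
      a₂ = proj₁ (remQuot {nA} nB y) ; b₂ = proj₂ (remQuot {nA} nB y)
  in (⌊ a₁ ≟ a₂ ⌋ ∧ adjB b₁ b₂) ∨ (adjA a₁ a₂ ∧ ⌊ b₁ ≟ f a₂ ⌋ ∧ ⌊ b₂ ≟ f a₁ ⌋)

-- The copy of B over a vertex a of A meets the copy over a neighbour a′ in the
-- single edge (a , f a′)(a′ , f a), so every copy is attached to its neighbours
-- through the ports of B: twice through the red port, once each through the blue
-- and green ones.
--
-- (⇐) Deleting two vertices leaves the copies over A - {a₁ , a₂} intact and joined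
-- along A - {a₁ , a₂}. In a damaged copy every component of what is left contains
-- enough ports (by the ℬ* condition, a component of B minus h ≤ 2 vertices carries
-- port weight at least 3 - h, red counting twice) to escape into an intact copy.
-- If A - {a₁ , a₂} is disconnected, sharpness gives at a₁ or a₂ a red and a
-- non-red neighbour on each side, and at least one colour still crosses the copy.
--
-- (⇒) If a is a cut vertex of A, one side Z of A - a has at most two neighbours of
-- a, and the corresponding vertices of the copy of a separate the copies over Z.
-- For a 2-cut {a₁ , a₂}, every component C of the rest is joined to both aᵢ, and
-- since A is 4-regular it sends an even number of edges to them; 1 + 1 edges would
-- again give a 2-cut of the product, so C sends at least four. With only eight
-- edges available there are exactly two components and a₁ ≁ a₂. If the colour
-- condition failed at both aᵢ, each aᵢ would reach one side through a single port
-- qᵢ, and {(a₁ , q₁) , (a₂ , q₂)} would be a 2-cut of the product.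

module Submission where

open import Defs
open import Data.Bool using (Bool; true; false; _∧_; _∨_; not; if_then_else_)
open import Data.Bool.Properties
  using (∧-zeroʳ; ∧-identityʳ; ∧-comm; ∧-distribʳ-∨; ∨-conicalˡ; ∨-conicalʳ) renaming (_≟_ to _≟ᵇ_)
open import Data.Empty using (⊥; ⊥-elim)
open import Data.Fin using (Fin; zero; suc; combine; remQuot; fromℕ<)
open import Data.Fin.Properties using (_≟_; all?; ¬∀⟶∃¬; remQuot-combine; combine-remQuot)
open import Data.List using (List; []; _∷_; map; length)
open import Data.List.Membership.Propositional using (_∈_; _∉_)
open import Data.List.Relation.Unary.All using (All; []; _∷_)
open import Data.List.Relation.Unary.Any using (here; there)
open import Data.List.Relation.Unary.Unique.Propositional using (Unique; []; _∷_)
open import Data.Nat using (ℕ; zero; suc; _+_; _*_; _∸_; _≤_; _<_; z≤n; s≤s)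
open import Data.Nat.Divisibility using (_∣_; divides; ∣m∣n⇒∣m+n; ∣m+n∣m⇒∣n)
open import Data.Nat.ListAction using (sum)
open import Data.Nat.Properties
  using ( ≤-refl; ≤-reflexive; ≤-trans; ≤-<-trans; ≤-pred; <-irrefl; <⇒≱; ≤ᵇ⇒≤; suc-injective; 1+n≢n
        ; +-assoc; +-identityʳ; +-cancelˡ-≡; +-mono-≤; +-monoʳ-≤; m≤n+m; *-comm; *-mono-≤
        ; ∸-monoʳ-≤; m∸[m∸n]≡n; n∸n≡0; +-commutativeSemigroup; module ≤-Reasoning )
open import Data.Product using (∃; ∃₂; _×_; _,_; proj₁; proj₂)
open import Data.Sum using (_⊎_; inj₁; inj₂; [_,_]′; swap)
open import Function using (id; _∘_; _⇔_; mk⇔; Equivalence)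
open import Relation.Binary.PropositionalEquality
open import Relation.Nullary using (¬_; yes; no; Dec)
open import Relation.Nullary.Decidable using (⌊_⌋; _→-dec_)

open import Algebra.Properties.CommutativeSemigroup +-commutativeSemigroup using (interchange; x∙yz≈y∙xz)

ind : Bool → ℕ
ind b = if b then 1 else 0

true≢false : ∀ {b} → b ≡ true → b ≡ false → ⊥
true≢false refl ()

∧-true : ∀ {a b} → a ∧ b ≡ true → a ≡ true × b ≡ true
∧-true {true} e = refl , e

∨-true : ∀ {a b} → a ∨ b ≡ true → a ≡ true ⊎ b ≡ true
∨-true {true}  _ = inj₁ refl
∨-true {false} e = inj₂ e

∨-trueʳ : ∀ a {b} → b ≡ true → a ∨ b ≡ true
∨-trueʳ true  _ = refl
∨-trueʳ false e = e

≡-from-⇔true : ∀ {a b} → (a ≡ true → b ≡ true) → (b ≡ true → a ≡ true) → a ≡ b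
≡-from-⇔true {true}  a⇒b _   = sym (a⇒b refl)
≡-from-⇔true {false} {true} _ b⇒a = b⇒a refl
≡-from-⇔true {false} {false} _ _ = refl

ind≤1 : ∀ b → ind b ≤ 1
ind≤1 true  = ≤-refl
ind≤1 false = z≤n

ind+ind≡1 : ∀ {a b} → ind a + ind b ≡ 1 → a ≡ true ⊎ b ≡ true
ind+ind≡1 {true}         _ = inj₁ refl
ind+ind≡1 {false} {true} _ = inj₂ refl

not-true : ∀ {a} → not a ≡ true → a ≡ false
not-true {false} _ = refl

_≡ᵇ_ : ∀ {n} → Fin n → Fin n → Bool
x ≡ᵇ y = ⌊ x ≟ y ⌋

≡ᵇ-refl : ∀ {n} (x : Fin n) → x ≡ᵇ x ≡ true
≡ᵇ-refl x with x ≟ x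
... | yes _  = refl
... | no x≢x = ⊥-elim (x≢x refl)

≡ᵇ⇒≡ : ∀ {n} {x y : Fin n} → x ≡ᵇ y ≡ true → x ≡ y
≡ᵇ⇒≡ {x = x} {y} e with x ≟ y
... | yes x≡y = x≡y

≢⇒≡ᵇ-false : ∀ {n} {x y : Fin n} → x ≢ y → x ≡ᵇ y ≡ false
≢⇒≡ᵇ-false {x = x} {y} x≢y with x ≟ y
... | yes x≡y = ⊥-elim (x≢y x≡y)
... | no _    = refl

≡ᵇ-false⇒≢ : ∀ {n} {x y : Fin n} → x ≡ᵇ y ≡ false → x ≢ y
≡ᵇ-false⇒≢ {x = x} e refl = true≢false (≡ᵇ-refl x) e

≡ᵇ-sym : ∀ {n} (x y : Fin n) → (x ≡ᵇ y) ≡ (y ≡ᵇ x)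
≡ᵇ-sym x y = ≡-from-⇔true (λ e → subst (λ z → z ≡ᵇ x ≡ true) (≡ᵇ⇒≡ e) (≡ᵇ-refl x))
                          (λ e → subst (λ z → z ≡ᵇ y ≡ true) (≡ᵇ⇒≡ e) (≡ᵇ-refl y))

≡ᵇ-suc : ∀ {n} (x y : Fin n) → (suc x ≡ᵇ suc y) ≡ (x ≡ᵇ y)
≡ᵇ-suc x y with x ≟ y
... | yes _ = refl
... | no _  = refl

pair-false : ∀ {n} {a b x : Fin n} → x ≢ a → x ≢ b → pair a b x ≡ false
pair-false x≢a x≢b rewrite ≢⇒≡ᵇ-false x≢a | ≢⇒≡ᵇ-false x≢b = refl

pair-true : ∀ {n} {a b x : Fin n} → pair a b x ≡ true → x ≡ a ⊎ x ≡ b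
pair-true {a = a} {x = x} e with ∨-true {x ≡ᵇ a} e
... | inj₁ e₁ = inj₁ (≡ᵇ⇒≡ e₁)
... | inj₂ e₂ = inj₂ (≡ᵇ⇒≡ e₂)

pair-inˡ : ∀ {n} (a b : Fin n) → pair a b a ≡ true
pair-inˡ a b rewrite ≡ᵇ-refl a = refl

pair-inʳ : ∀ {n} (a b : Fin n) → pair a b b ≡ true
pair-inʳ a b = ∨-trueʳ (b ≡ᵇ a) (≡ᵇ-refl b)

pair-pigeonhole : ∀ {n} {a b x y z : Fin n} → pair a b x ≡ true → pair a b y ≡ true → pair a b z ≡ true →
                  x ≢ z → y ≢ z → x ≡ y
pair-pigeonhole {a = a} {b} {x} {y} {z} x∈ y∈ z∈ x≢z y≢z
  with pair-true {a = a} {b} {x} x∈ | pair-true {a = a} {b} {y} y∈ | pair-true {a = a} {b} {z} z∈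
... | inj₁ refl | inj₁ refl | _         = refl
... | inj₂ refl | inj₂ refl | _         = refl
... | inj₁ refl | inj₂ refl | inj₁ refl = ⊥-elim (x≢z refl)
... | inj₁ refl | inj₂ refl | inj₂ refl = ⊥-elim (y≢z refl)
... | inj₂ refl | inj₁ refl | inj₁ refl = ⊥-elim (y≢z refl)
... | inj₂ refl | inj₁ refl | inj₂ refl = ⊥-elim (x≢z refl)

pair-false⇒≢ˡ : ∀ {n} {a b x : Fin n} → pair a b x ≡ false → x ≢ a
pair-false⇒≢ˡ {a = a} {b} e refl = true≢false (pair-inˡ a b) e

pair-false⇒≢ʳ : ∀ {n} {a b x : Fin n} → pair a b x ≡ false → x ≢ b
pair-false⇒≢ʳ {a = a} {b} e refl = true≢false (pair-inʳ a b) e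

-- Finite sums and counting

_without_ : ∀ {n} → (Fin n → ℕ) → Fin n → Fin n → ℕ
(g without x) i = if i ≡ᵇ x then 0 else g i

sumFin-cong : ∀ {n} {g h : Fin n → ℕ} → (∀ i → g i ≡ h i) → sumFin g ≡ sumFin h
sumFin-cong {zero}  e = refl
sumFin-cong {suc n} e = cong₂ _+_ (e zero) (sumFin-cong (λ i → e (suc i)))

sumFin-mono : ∀ {n} {g h : Fin n → ℕ} → (∀ i → g i ≤ h i) → sumFin g ≤ sumFin h
sumFin-mono {zero}  e = z≤n
sumFin-mono {suc n} e = +-mono-≤ (e zero) (sumFin-mono (λ i → e (suc i)))

sumFin-+ : ∀ {n} (g h : Fin n → ℕ) → sumFin (λ i → g i + h i) ≡ sumFin g + sumFin h
sumFin-+ {zero}  g h = refl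
sumFin-+ {suc n} g h =
  trans (cong ((g zero + h zero) +_) (sumFin-+ (λ i → g (suc i)) (λ i → h (suc i))))
        (interchange (g zero) (h zero) (sumFin (λ i → g (suc i))) (sumFin (λ i → h (suc i))))

sumFin-zero : ∀ {n} {g : Fin n → ℕ} → (∀ i → g i ≡ 0) → sumFin g ≡ 0
sumFin-zero {zero}  e = refl
sumFin-zero {suc n} e rewrite e zero = sumFin-zero (λ i → e (suc i))

sumFin-remove : ∀ {n} (g : Fin n → ℕ) (x : Fin n) → sumFin g ≡ g x + sumFin (g without x)
sumFin-remove {suc n} g zero    = refl
sumFin-remove {suc n} g (suc x) = begin
  g zero + sumFin (λ i → g (suc i))
    ≡⟨ cong (g zero +_) (sumFin-remove (λ i → g (suc i)) x) ⟩
  g zero + (g (suc x) + sumFin ((λ i → g (suc i)) without x))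
    ≡⟨ x∙yz≈y∙xz (g zero) (g (suc x)) _ ⟩
  g (suc x) + (g zero + sumFin ((λ i → g (suc i)) without x))
    ≡⟨ cong (λ s → g (suc x) + (g zero + s)) (sumFin-cong shift) ⟩
  g (suc x) + sumFin (g without suc x) ∎
  where
  open ≡-Reasoning
  shift : ∀ i → ((λ i → g (suc i)) without x) i ≡ (g without suc x) (suc i)
  shift i rewrite ≡ᵇ-suc i x = refl

map-without : ∀ {n} (g : Fin n → ℕ) {x : Fin n} {xs} → All (x ≢_) xs → map (g without x) xs ≡ map g xs
map-without g [] = refl
map-without g (x≢y ∷ x≢ys) rewrite ≢⇒≡ᵇ-false (λ y≡x → x≢y (sym y≡x)) = cong (_ ∷_) (map-without g x≢ys)

sumFin-support : ∀ {n} (g : Fin n → ℕ) {xs : List (Fin n)} → Unique xs →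
                 (∀ v → v ∉ xs → g v ≡ 0) → sumFin g ≡ sum (map g xs)
sumFin-support g [] off = sumFin-zero (λ v → off v (λ ()))
sumFin-support g {x ∷ xs} (x∉xs ∷ uniq) off = begin
  sumFin g                         ≡⟨ sumFin-remove g x ⟩
  g x + sumFin (g without x)       ≡⟨ cong (g x +_) (sumFin-support (g without x) uniq off′) ⟩
  g x + sum (map (g without x) xs) ≡⟨ cong (λ l → g x + sum l) (map-without g x∉xs) ⟩
  g x + sum (map g xs)             ∎
  where
  open ≡-Reasoning
  off′ : ∀ v → v ∉ xs → (g without x) v ≡ 0
  off′ v v∉xs with v ≟ x
  ... | yes _   = refl
  ... | no  v≢x = off v λ { (here v≡x) → v≢x v≡x ; (there v∈xs) → v∉xs v∈xs }

sum-points≤sumFin : ∀ {n} (g : Fin n → ℕ) {xs : List (Fin n)} → Unique xs → sum (map g xs) ≤ sumFin g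
sum-points≤sumFin g [] = z≤n
sum-points≤sumFin g {x ∷ xs} (x∉xs ∷ uniq) = begin
  g x + sum (map g xs)             ≡⟨ cong (λ l → g x + sum l) (map-without g x∉xs) ⟨
  g x + sum (map (g without x) xs) ≤⟨ +-monoʳ-≤ (g x) (sum-points≤sumFin (g without x) uniq) ⟩
  g x + sumFin (g without x)       ≡⟨ sumFin-remove g x ⟨
  sumFin g                         ∎
  where open ≤-Reasoning

count>0⇒witness : ∀ {n} {P : Fin n → Bool} → 0 < count P → ∃ λ v → P v ≡ true
count>0⇒witness {suc n} {P} c with P zero in P0
... | true  = zero , P0
... | false = let v , Pv = count>0⇒witness {n} {λ i → P (suc i)} c in suc v , Pv

module _ {n : ℕ} where

  count-cong : {P Q : Fin n → Bool} → (∀ i → P i ≡ Q i) → count P ≡ count Q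
  count-cong e = sumFin-cong (λ i → cong ind (e i))

  count-mono : {P Q : Fin n → Bool} → (∀ i → P i ≡ true → Q i ≡ true) → count P ≤ count Q
  count-mono P⊆Q = sumFin-mono (λ i → ind-mono (P⊆Q i))
    where
    ind-mono : ∀ {a b} → (a ≡ true → b ≡ true) → ind a ≤ ind b
    ind-mono {false} _ = z≤n
    ind-mono {true}  h rewrite h refl = ≤-refl

  count-all : count {n} (λ _ → true) ≡ n
  count-all = go n
    where
    go : ∀ m → count {m} (λ _ → true) ≡ m
    go zero    = refl
    go (suc m) = cong suc (go m)

  count≤n : (P : Fin n → Bool) → count P ≤ n
  count≤n P = ≤-trans (count-mono (λ _ _ → refl)) (≤-reflexive count-all)

  count-remove : (P : Fin n → Bool) (x : Fin n) →
                 count P ≡ ind (P x) + count (λ i → P i ∧ not (i ≡ᵇ x))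
  count-remove P x = trans (sumFin-remove (λ i → ind (P i)) x) (cong (ind (P x) +_) (sumFin-cong pointwise))
    where
    pointwise : ∀ i → ((λ i → ind (P i)) without x) i ≡ ind (P i ∧ not (i ≡ᵇ x))
    pointwise i with i ≡ᵇ x
    ... | true  = cong ind (sym (∧-zeroʳ (P i)))
    ... | false = cong ind (sym (∧-identityʳ (P i)))

  count-pos : {P : Fin n → Bool} (v : Fin n) → P v ≡ true → 0 < count P
  count-pos {P} v Pv rewrite count-remove P v | Pv = s≤s z≤n

  count-strict : {P Q : Fin n → Bool} → (∀ i → P i ≡ true → Q i ≡ true) →
                 (v : Fin n) → Q v ≡ true → P v ≡ false → count P < count Q
  count-strict {P} {Q} P⊆Q v Qv Pv rewrite count-remove P v | count-remove Q v | Pv | Qv =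
    s≤s (count-mono λ i e → let Pi , i≢v = ∧-true e in cong₂ _∧_ (P⊆Q i Pi) i≢v)

  count≡0⇒false : {P : Fin n → Bool} → count P ≡ 0 → ∀ v → P v ≡ false
  count≡0⇒false {P} c v with P v in Pv
  ... | false = refl
  ... | true  = ⊥-elim (<-irrefl (sym c) (count-pos v Pv))


  count-without : {P : Fin n → Bool} {k : ℕ} (x : Fin n) → P x ≡ true → count P ≡ suc k →
                  count (λ i → P i ∧ not (i ≡ᵇ x)) ≡ k
  count-without {P} x Px c with count-remove P x
  ... | e rewrite Px = suc-injective (trans (sym e) c)

  count≡1⇒unique : {P : Fin n → Bool} → count P ≡ 1 → ∃ λ x → P x ≡ true × (∀ y → P y ≡ true → y ≡ x)
  count≡1⇒unique {P} c with count>0⇒witness {P = P} (≤-reflexive (sym c))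
  ... | x , Px = x , Px , only-x
    where
    rest-empty : count (λ i → P i ∧ not (i ≡ᵇ x)) ≡ 0
    rest-empty = count-without x Px c
    only-x : ∀ y → P y ≡ true → y ≡ x
    only-x y Py with y ≟ x | count≡0⇒false rest-empty y
    ... | yes y≡x | _ = y≡x
    ... | no  _   | e rewrite Py = ⊥-elim (true≢false refl e)

  count≡2⇒two : {P : Fin n → Bool} → count P ≡ 2 →
    ∃₂ λ x y → x ≢ y × P x ≡ true × P y ≡ true × (∀ z → P z ≡ true → z ≡ x ⊎ z ≡ y)
  count≡2⇒two {P} c with count>0⇒witness {P = P} (≤-trans (s≤s z≤n) (≤-reflexive (sym c)))
  ... | x , Px with count≡1⇒unique {P = λ i → P i ∧ not (i ≡ᵇ x)}
                      (count-without x Px c)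
  ... | y , Py∧y≢x , only-y = x , y , x≢y , Px , proj₁ (∧-true Py∧y≢x) , cover
    where
    x≢y : x ≢ y
    x≢y refl = true≢false (proj₂ (∧-true Py∧y≢x)) (cong not (≡ᵇ-refl x))
    cover : ∀ z → P z ≡ true → z ≡ x ⊎ z ≡ y
    cover z Pz with z ≟ x
    ... | yes z≡x = inj₁ z≡x
    ... | no  z≢x = inj₂ (only-y z (cong₂ _∧_ Pz (cong not (≢⇒≡ᵇ-false z≢x))))

  count≤2⇒covered : {P : Fin n → Bool} → count P ≤ 2 → Fin n → ∃₂ λ s t → ∀ v → P v ≡ true → v ≡ s ⊎ v ≡ t
  count≤2⇒covered {P} c≤2 d with count P in c
  ... | 0 = d , d , λ v Pv → ⊥-elim (true≢false Pv (count≡0⇒false c v))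
  ... | 1 = let s , _ , only-s = count≡1⇒unique c in s , s , λ v Pv → inj₁ (only-s v Pv)
  ... | 2 = let s , t , _ , _ , _ , cover = count≡2⇒two c in s , t , cover
  ... | suc (suc (suc _)) with s≤s (s≤s ()) ← c≤2

  count-∨ : {P Q : Fin n → Bool} → (∀ i → P i ∧ Q i ≡ false) → count (λ i → P i ∨ Q i) ≡ count P + count Q
  count-∨ {P} {Q} disjoint = trans (sumFin-cong pointwise) (sumFin-+ (λ i → ind (P i)) (λ i → ind (Q i)))
    where
    pointwise : ∀ i → ind (P i ∨ Q i) ≡ ind (P i) + ind (Q i)
    pointwise i with P i | Q i | disjoint i
    ... | true  | false | _ = refl
    ... | false | _     | _ = refl

  count-split : (P Q : Fin n → Bool) → count P ≡ count (λ i → P i ∧ Q i) + count (λ i → P i ∧ not (Q i))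
  count-split P Q = trans (count-cong pointwise) (count-∨ disjoint)
    where
    pointwise : ∀ i → P i ≡ ((P i ∧ Q i) ∨ (P i ∧ not (Q i)))
    pointwise i with P i | Q i
    ... | true  | true  = refl
    ... | true  | false = refl
    ... | false | _     = refl
    disjoint : ∀ i → (P i ∧ Q i) ∧ (P i ∧ not (Q i)) ≡ false
    disjoint i with P i | Q i
    ... | true  | true  = refl
    ... | true  | false = refl
    ... | false | _     = refl

  count-support : {P : Fin n → Bool} {xs : List (Fin n)} → Unique xs → (∀ v → P v ≡ true → v ∈ xs) →
                  count P ≡ sum (map (λ v → ind (P v)) xs)
  count-support {P} uniq P⊆xs = sumFin-support (λ v → ind (P v)) uniq off
    where
    off : ∀ v → v ∉ _ → ind (P v) ≡ 0
    off v v∉xs with P v in Pv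
    ... | true  = ⊥-elim (v∉xs (P⊆xs v Pv))
    ... | false = refl

  two≤count : {P : Fin n → Bool} {x y : Fin n} → x ≢ y → P x ≡ true → P y ≡ true → 2 ≤ count P
  two≤count {P} x≢y Px Py with sum-points≤sumFin (λ v → ind (P v)) ((x≢y ∷ []) ∷ [] ∷ [])
  ... | bound rewrite Px | Py = bound

  count≤1⇒unique : {P : Fin n → Bool} {x y : Fin n} → count P ≤ 1 → P x ≡ true → P y ≡ true → x ≡ y
  count≤1⇒unique {x = x} {y} c≤1 Px Py with x ≟ y
  ... | yes x≡y = x≡y
  ... | no  x≢y = ⊥-elim (<-irrefl refl (≤-trans (two≤count x≢y Px Py) c≤1))

  exists-outside : {P : Fin n → Bool} → count P < n → ∃ λ v → P v ≡ false
  exists-outside {P} c<n = let v , e = count>0⇒witness {P = λ v → not (P v)} positive in v , not-true e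
    where
    total : n ≡ count P + count (λ v → not (P v))
    total = trans (sym count-all) (count-split (λ _ → true) P)
    positive : 0 < count (λ v → not (P v))
    positive with count (λ v → not (P v)) | total
    ... | zero  | n≡ = ⊥-elim (<-irrefl (sym (trans n≡ (+-identityʳ _))) c<n)
    ... | suc _ | _  = s≤s z≤n

  count≤length : {P : Fin n → Bool} (xs : List (Fin n)) → (∀ v → P v ≡ true → v ∈ xs) → count P ≤ length xs
  count≤length {P = P} [] P⊆xs = ≤-reflexive (sumFin-zero λ v → cong ind (count-empty v))
    where
    count-empty : ∀ v → P v ≡ false
    count-empty v with P v in Pv
    ... | true  with () ← P⊆xs v Pv
    ... | false = refl
  count≤length {P = P} (x ∷ xs) P⊆xs = begin
    count P                                    ≡⟨ count-remove P x ⟩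
    ind (P x) + count (λ i → P i ∧ not (i ≡ᵇ x)) ≤⟨ +-mono-≤ (ind≤1 (P x)) (count≤length xs rest⊆xs) ⟩
    suc (length xs)                            ∎
    where
    open ≤-Reasoning
    rest⊆xs : ∀ v → P v ∧ not (v ≡ᵇ x) ≡ true → v ∈ xs
    rest⊆xs v e with ∧-true e
    ... | Pv , v≢x with P⊆xs v Pv
    ...   | here v≡x rewrite v≡x | ≡ᵇ-refl x with () ← v≢x
    ...   | there v∈xs = v∈xs

-- Paths and reachability

module _ {n : ℕ} {adj : Adj n} {W : Fin n → Bool} where

  path-++ : ∀ {u v w} → Path adj W u v → Path adj W v w → Path adj W u w
  path-++ here            q = q
  path-++ (step a w∉ p) q = step a w∉ (path-++ p q)

  path-snoc : ∀ {u v w} → Path adj W u v → adj v w ≡ true → W w ≡ false → Path adj W u w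
  path-snoc p a w∉ = path-++ p (step a w∉ here)

  path-reverse : (∀ x y → adj x y ≡ adj y x) → ∀ {u v} → W u ≡ false → Path adj W u v → Path adj W v u
  path-reverse adj-sym u∉ here = here
  path-reverse adj-sym {u} u∉ (step {v = v} a v∉ p) =
    path-snoc (path-reverse adj-sym v∉ p) (trans (adj-sym v u) a) u∉

  path-avoids : ∀ {u v} → Path adj W u v → W u ≡ false → W v ≡ false
  path-avoids here          u∉ = u∉
  path-avoids (step _ v∉ p) _  = path-avoids p v∉

  path-stays : (Z : Fin n → Bool) →
    (∀ x y → Z x ≡ true → W x ≡ false → adj x y ≡ true → W y ≡ false → Z y ≡ true) →
    ∀ {u v} → Z u ≡ true → W u ≡ false → Path adj W u v → Z v ≡ true
  path-stays Z closed Zu u∉ here         = Zu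
  path-stays Z closed Zu u∉ (step a v∉ p) = path-stays Z closed (closed _ _ Zu u∉ a v∉) v∉ p

path-weaken : ∀ {n} {adj : Adj n} {W W′ : Fin n → Bool} →
  (∀ x → W x ≡ false → W′ x ≡ false) → ∀ {u v} → Path adj W u v → Path adj W′ u v
path-weaken W′⊆W here          = here
path-weaken W′⊆W (step a v∉ p) = step a (W′⊆W _ v∉) (path-weaken W′⊆W p)

path-map : ∀ {n m} {adj : Adj n} {W : Fin n → Bool} {adj′ : Adj m} {W′ : Fin m → Bool}
  (h : Fin n → Fin m) →
  (∀ x y → adj x y ≡ true → adj′ (h x) (h y) ≡ true) → (∀ y → W y ≡ false → W′ (h y) ≡ false) →
  ∀ {u v} → Path adj W u v → Path adj′ W′ (h u) (h v)
path-map h hom avoid here          = here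
path-map h hom avoid (step a v∉ p) = step (hom _ _ a) (avoid _ v∉) (path-map h hom avoid p)

connected-via-hub : ∀ {n} {adj : Adj n} {W : Fin n → Bool} → (∀ x y → adj x y ≡ adj y x) →
  (hub : Fin n) → (∀ x → W x ≡ false → Path adj W x hub) → ConnAvoid adj W
connected-via-hub adj-sym hub to-hub u v u∉ v∉ = path-++ (to-hub u u∉) (path-reverse adj-sym v∉ (to-hub v v∉))

module _ {n : ℕ} (P : Fin n → Bool) (c : Bool) (Q : Fin n → Bool) where

  private
    implies? : ∀ v → Dec (P v ≡ c → Q v ≡ true)
    implies? v = (P v ≟ᵇ c) →-dec (Q v ≟ᵇ true)

    counterexample : ∀ {a b} → ¬ (a ≡ c → b ≡ true) → a ≡ c × b ≡ false
    counterexample {a} {b} ¬implies with a ≟ᵇ c | b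
    ... | yes a≡c | false = a≡c , refl
    ... | yes _   | true  = ⊥-elim (¬implies λ _ → refl)
    ... | no  a≢c | _     = ⊥-elim (¬implies λ a≡c → ⊥-elim (a≢c a≡c))

  implies-or-counterexample : (∀ v → P v ≡ c → Q v ≡ true) ⊎ (∃ λ v → P v ≡ c × Q v ≡ false)
  implies-or-counterexample with all? implies?
  ... | yes all = inj₁ all
  ... | no ¬all = let v , ¬implies = ¬∀⟶∃¬ n _ implies? ¬all in inj₂ (v , counterexample ¬implies)

anyᵇ : ∀ {n} → (Fin n → Bool) → Bool
anyᵇ {zero}  P = false
anyᵇ {suc n} P = P zero ∨ anyᵇ (λ i → P (suc i))

anyᵇ-intro : ∀ {n} {P : Fin n → Bool} x → P x ≡ true → anyᵇ P ≡ true
anyᵇ-intro {P = P} zero    Px rewrite Px = refl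
anyᵇ-intro {P = P} (suc x) Px = ∨-trueʳ (P zero) (anyᵇ-intro x Px)

anyᵇ-elim : ∀ {n} {P : Fin n → Bool} → anyᵇ P ≡ true → ∃ λ x → P x ≡ true
anyᵇ-elim {suc n} {P} e with ∨-true {P zero} e
... | inj₁ P0 = zero , P0
... | inj₂ e′ = let x , Px = anyᵇ-elim e′ in suc x , Px

anyᵇ-cong : ∀ {n} {P Q : Fin n → Bool} → (∀ x → P x ≡ Q x) → anyᵇ P ≡ anyᵇ Q
anyᵇ-cong {zero}  e = refl
anyᵇ-cong {suc n} e = cong₂ _∨_ (e zero) (anyᵇ-cong (λ i → e (suc i)))

-- Breadth-first search from u in G - W: layer k holds the vertices at distance at
-- most k, and the layers are stable after n rounds since each growth adds a vertex.
module Reach {n : ℕ} (adj : Adj n) (W : Fin n → Bool) (u : Fin n) where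

  layer : ℕ → Fin n → Bool
  layer zero    v = v ≡ᵇ u
  layer (suc k) v = layer k v ∨ (not (W v) ∧ anyᵇ (λ w → layer k w ∧ adj w v))

  layer-suc : ∀ k {v} → layer k v ≡ true → layer (suc k) v ≡ true
  layer-suc k e rewrite e = refl

  layer-start : ∀ k → layer k u ≡ true
  layer-start zero    = ≡ᵇ-refl u
  layer-start (suc k) = layer-suc k (layer-start k)

  layer-sound : ∀ k v → layer k v ≡ true → Path adj W u v
  layer-sound zero    v e rewrite ≡ᵇ⇒≡ e = here
  layer-sound (suc k) v e with ∨-true {layer k v} e
  ... | inj₁ e′ = layer-sound k v e′
  ... | inj₂ e′ with ∧-true {not (W v)} e′
  ...   | v∉ , near with anyᵇ-elim near
  ...     | w , lw∧a = path-snoc (layer-sound k w (proj₁ (∧-true lw∧a))) (proj₂ (∧-true lw∧a)) (not-true v∉)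

  Stable : ℕ → Set
  Stable k = ∀ v → layer (suc k) v ≡ true → layer k v ≡ true

  stable-suc : ∀ k → Stable k → Stable (suc k)
  stable-suc k st v e =
    trans (sym (cong₂ _∨_ (same v) (cong (not (W v) ∧_) (anyᵇ-cong λ w → cong (_∧ adj w v) (same w))))) e
    where
    same : ∀ w → layer (suc k) w ≡ layer k w
    same w = ≡-from-⇔true (st w) (layer-suc k)

  grows : ∀ k → Stable k ⊎ k < count (layer k)
  grows zero = inj₂ (count-pos u (≡ᵇ-refl u))
  grows (suc k) with grows k
  ... | inj₁ st  = inj₁ (stable-suc k st)
  ... | inj₂ k<c with implies-or-counterexample (layer (suc k)) true (layer k)
  ...   | inj₁ st               = inj₁ (stable-suc k st)
  ...   | inj₂ (v , new , old) = inj₂ (≤-trans (s≤s k<c) (count-strict (λ _ → layer-suc k) v new old))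

  reach : Fin n → Bool
  reach = layer n

  reach-start : reach u ≡ true
  reach-start = layer-start n

  reach-sound : ∀ v → reach v ≡ true → Path adj W u v
  reach-sound = layer-sound n

  reach-closed : ∀ x y → reach x ≡ true → adj x y ≡ true → W y ≡ false → reach y ≡ true
  reach-closed x y rx a y∉ with grows n
  ... | inj₁ st  = st y (∨-trueʳ (layer n y) (cong₂ _∧_ (cong not y∉) (anyᵇ-intro x (cong₂ _∧_ rx a))))
  ... | inj₂ n<c = ⊥-elim (<-irrefl refl (≤-trans n<c (count≤n (layer n))))

  unreached-closed : (∀ x y → adj x y ≡ adj y x) →
    ∀ x y → reach x ≡ false → W x ≡ false → adj x y ≡ true → reach y ≡ false
  unreached-closed adj-sym x y rx x∉ a with reach y in ry
  ... | false = refl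
  ... | true  = ⊥-elim (true≢false (reach-closed y x ry (trans (adj-sym y x) a) x∉) rx)

  reach-complete : ∀ {v} → Path adj W u v → reach v ≡ true
  reach-complete = go reach-start
    where
    go : ∀ {x v} → reach x ≡ true → Path adj W x v → reach v ≡ true
    go rx here          = rx
    go rx (step a y∉ p) = go (reach-closed _ _ rx a y∉) p

  reach-avoids : W u ≡ false → ∀ x → reach x ≡ true → W x ≡ false
  reach-avoids u∉ x rx = path-avoids (reach-sound x rx) u∉

  reach-isComponent : (∀ x y → adj x y ≡ adj y x) → W u ≡ false → IsComponent adj W reach
  reach-isComponent adj-sym u∉ = record
    { nonempty = u , reach-start
    ; avoids   = reach-avoids u∉
    ; conn     = λ x y rx ry → path-++ (path-reverse adj-sym u∉ (reach-sound x rx)) (reach-sound y ry)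
    ; closed   = λ x y rx y∉ a → reach-closed x y rx a y∉ }

-- Parity and arithmetic

even-double : ∀ m → 2 ∣ m + m
even-double m = divides m (trans (cong (m +_) (sym (+-identityʳ m))) (*-comm 2 m))

sumFin-even : ∀ {n} {g : Fin n → ℕ} → (∀ i → 2 ∣ g i) → 2 ∣ sumFin g
sumFin-even {zero}  _    = divides 0 refl
sumFin-even {suc n} even = ∣m∣n⇒∣m+n (even zero) (sumFin-even (λ i → even (suc i)))

-- Each off-diagonal entry is counted twice.
double-sum-even : ∀ {n} (M : Fin n → Fin n → ℕ) → (∀ i j → M i j ≡ M j i) → (∀ i → M i i ≡ 0) →
                  2 ∣ sumFin (λ i → sumFin (M i))
double-sum-even {zero}  M _      _    = divides 0 refl
double-sum-even {suc n} M M-sym diag =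
  subst (2 ∣_) (sym split)
    (∣m∣n⇒∣m+n (even-double T) (double-sum-even (λ i j → M (suc i) (suc j)) (λ i j → M-sym (suc i) (suc j)) (diag ∘ suc)))
  where
  T R : ℕ
  T = sumFin (λ j → M zero (suc j))
  R = sumFin (λ i → sumFin (λ j → M (suc i) (suc j)))
  split : sumFin (λ i → sumFin (M i)) ≡ (T + T) + R
  split = begin
    (M zero zero + T) + sumFin (λ i → M (suc i) zero + sumFin (λ j → M (suc i) (suc j)))
      ≡⟨ cong₂ _+_ (cong (_+ T) (diag zero))
                   (sumFin-+ (λ i → M (suc i) zero) (λ i → sumFin (λ j → M (suc i) (suc j)))) ⟩
    T + (sumFin (λ i → M (suc i) zero) + R)
      ≡⟨ cong (λ s → T + (s + R)) (sumFin-cong (λ i → M-sym (suc i) zero)) ⟩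
    T + (T + R)
      ≡⟨ +-assoc T T R ⟨
    (T + T) + R ∎
    where open ≡-Reasoning

module _ {n : ℕ} {adj : Adj n} (simple : IsSimple adj) where

  -- Handshake lemma relative to C: the degrees inside C add up to twice the
  -- number of edges inside C plus the number of edges leaving C.
  boundary-even : (C : Fin n → Bool) → (∀ v → C v ≡ true → 2 ∣ deg adj v) →
                  2 ∣ sumFin (λ v → if C v then count (λ w → adj v w ∧ not (C w)) else 0)
  boundary-even C C-even = ∣m+n∣m⇒∣n total-even inner-even
    where
    M : Fin n → Fin n → ℕ
    M v w = ind (C v ∧ (adj v w ∧ C w))
    inner : Fin n → ℕ
    inner v = if C v then count (λ w → adj v w ∧ C w) else 0
    outer : Fin n → ℕ
    outer v = if C v then count (λ w → adj v w ∧ not (C w)) else 0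
    degrees : ∀ v → (if C v then deg adj v else 0) ≡ inner v + outer v
    degrees v with C v
    ... | true  = count-split (adj v) C
    ... | false = refl
    inner-rows : ∀ v → inner v ≡ sumFin (M v)
    inner-rows v with C v
    ... | true  = refl
    ... | false = sym (sumFin-zero {n} (λ _ → refl))
    M-sym : ∀ v w → M v w ≡ M w v
    M-sym v w rewrite IsSimple.sym simple v w with C v | C w
    ... | true  | true  = refl
    ... | true  | false = cong ind (∧-zeroʳ (adj w v))
    ... | false | true  = cong ind (sym (∧-zeroʳ (adj w v)))
    ... | false | false = refl
    M-diag : ∀ v → M v v ≡ 0
    M-diag v rewrite IsSimple.irrefl simple v with C v
    ... | true  = refl
    ... | false = refl
    total-even : 2 ∣ sumFin inner + sumFin outer
    total-even = subst (2 ∣_) (trans (sumFin-cong degrees) (sumFin-+ inner outer))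
                   (sumFin-even λ v → even-if v (C v) refl)
      where
      even-if : ∀ v b → C v ≡ b → 2 ∣ (if b then deg adj v else 0)
      even-if v true  Cv = C-even v Cv
      even-if v false _  = divides 0 refl
    inner-even : 2 ∣ sumFin inner
    inner-even = subst (2 ∣_) (sym (sumFin-cong inner-rows)) (double-sum-even M M-sym M-diag)

¬2∣3 : ¬ 2 ∣ 3
¬2∣3 (divides (suc (suc _)) ())

even-split : ∀ {p q} → 1 ≤ p → 1 ≤ q → 2 ∣ p + q → (p ≡ 1 × q ≡ 1) ⊎ 4 ≤ p + q
even-split {1} {1}                 _ _ _ = inj₁ (refl , refl)
even-split {1} {2}                 _ _ e = ⊥-elim (¬2∣3 e)
even-split {2} {1}                 _ _ e = ⊥-elim (¬2∣3 e)
even-split {1} {suc (suc (suc q))} _ _ _ = inj₂ (s≤s (s≤s (s≤s (s≤s z≤n))))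
even-split {2} {suc (suc q)}       _ _ _ = inj₂ (s≤s (s≤s (s≤s (s≤s z≤n))))
even-split {suc (suc (suc p))} {suc q} _ _ _ = inj₂ (s≤s (s≤s (s≤s (≤-trans (s≤s z≤n) (m≤n+m (suc q) p)))))

≤-interchange : ∀ {a b} p₁ q₁ p₂ q₂ → a ≤ p₁ + q₁ → b ≤ p₂ + q₂ → a + b ≤ (p₁ + p₂) + (q₁ + q₂)
≤-interchange {a} {b} p₁ q₁ p₂ q₂ h₁ h₂ = subst (a + b ≤_) (interchange p₁ q₁ p₂ q₂) (+-mono-≤ h₁ h₂)

sum4⇒≤2 : ∀ {p q} → p + q ≡ 4 → p ≤ 2 ⊎ q ≤ 2
sum4⇒≤2 {0}               _    = inj₁ z≤n
sum4⇒≤2 {1}               _    = inj₁ (s≤s z≤n)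
sum4⇒≤2 {2}               _    = inj₁ (s≤s (s≤s z≤n))
sum4⇒≤2 {suc (suc (suc p))} {q} e =
  inj₂ (≤-trans (m≤n+m q p) (≤-trans (≤-reflexive (suc-injective (suc-injective (suc-injective e)))) (s≤s z≤n)))

-- The Sierpiński product

module Sierpinski {nA nB : ℕ} (adjA : Adj nA) (adjB : Adj nB) (f : Fin nA → Fin nB) where

  V : Set
  V = Fin (nA * nB)

  adjP : Adj (nA * nB)
  adjP = sierpinski adjA adjB f

  pt : Fin nA → Fin nB → V
  pt = combine

  prA : V → Fin nA
  prA x = proj₁ (remQuot {nA} nB x)

  prB : V → Fin nB
  prB x = proj₂ (remQuot {nA} nB x)

  pt-prA-prB : ∀ x → pt (prA x) (prB x) ≡ x
  pt-prA-prB = combine-remQuot {nA} nB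

  prA-pt : ∀ a b → prA (pt a b) ≡ a
  prA-pt a b = cong proj₁ (remQuot-combine {nA} {nB} a b)

  prB-pt : ∀ a b → prB (pt a b) ≡ b
  prB-pt a b = cong proj₂ (remQuot-combine {nA} {nB} a b)

  pt-injective : ∀ {a b a′ b′} → pt a b ≡ pt a′ b′ → a ≡ a′ × b ≡ b′
  pt-injective {a} {b} {a′} {b′} e =
    trans (sym (prA-pt a b)) (trans (cong prA e) (prA-pt a′ b′)) ,
    trans (sym (prB-pt a b)) (trans (cong prB e) (prB-pt a′ b′))

  adjP-pt : ∀ a b a′ b′ → adjP (pt a b) (pt a′ b′) ≡ ((a ≡ᵇ a′ ∧ adjB b b′) ∨ (adjA a a′ ∧ b ≡ᵇ f a′ ∧ b′ ≡ᵇ f a))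
  adjP-pt a b a′ b′ rewrite prA-pt a b | prB-pt a b | prA-pt a′ b′ | prB-pt a′ b′ = refl

  adjP-cases : ∀ x y → adjP x y ≡ true →
    (prA x ≡ prA y × adjB (prB x) (prB y) ≡ true) ⊎
    (adjA (prA x) (prA y) ≡ true × prB x ≡ f (prA y) × prB y ≡ f (prA x))
  adjP-cases x y e with ∨-true {prA x ≡ᵇ prA y ∧ adjB (prB x) (prB y)} e
  ... | inj₁ copy = let same , b-edge = ∧-true copy in inj₁ (≡ᵇ⇒≡ same , b-edge)
  ... | inj₂ link = let a-edge , rest = ∧-true link ; e₁ , e₂ = ∧-true rest in
                    inj₂ (a-edge , ≡ᵇ⇒≡ e₁ , ≡ᵇ⇒≡ e₂)

  copy-edge : ∀ a {b b′} → adjB b b′ ≡ true → adjP (pt a b) (pt a b′) ≡ true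
  copy-edge a {b} {b′} e rewrite adjP-pt a b a b′ | ≡ᵇ-refl a | e = refl

  link-edge : ∀ {a a′} → adjA a a′ ≡ true → adjP (pt a (f a′)) (pt a′ (f a)) ≡ true
  link-edge {a} {a′} e rewrite adjP-pt a (f a′) a′ (f a) | e | ≡ᵇ-refl (f a′) | ≡ᵇ-refl (f a) =
    ∨-trueʳ (a ≡ᵇ a′ ∧ adjB (f a′) (f a)) refl

  adjP-sym : (∀ x y → adjA x y ≡ adjA y x) → (∀ x y → adjB x y ≡ adjB y x) → ∀ x y → adjP x y ≡ adjP y x
  adjP-sym symA symB x y =
    cong₂ _∨_ (cong₂ _∧_ (≡ᵇ-sym (prA x) (prA y)) (symB (prB x) (prB y)))
              (cong₂ _∧_ (symA (prA x) (prA y)) (∧-comm (prB x ≡ᵇ f (prA y)) (prB y ≡ᵇ f (prA x))))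

  copy-path : (S : V → Bool) (a : Fin nA) → ∀ {b b′} →
              Path adjB (λ c → S (pt a c)) b b′ → Path adjP S (pt a b) (pt a b′)
  copy-path S a = path-map (pt a) (λ _ _ → copy-edge a) (λ _ e → e)

-- Neighbourhoods in A and ports of B

==c⇒≡ : ∀ {c d} → (c ==c d) ≡ true → c ≡ d
==c⇒≡ {red}   {red}   _ = refl
==c⇒≡ {blue}  {blue}  _ = refl
==c⇒≡ {green} {green} _ = refl

colour-≢ : ∀ {n} (col : Fin n → Colour) {u v : Fin n} {c d} → col u ≡ c → col v ≡ d → c ≢ d → u ≢ v
colour-≢ col cu cv c≢d refl = c≢d (trans (sym cu) cv)

record Neighbourhood {n : ℕ} (adj : Adj n) (col : Fin n → Colour) (a : Fin n) : Set where
  field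
    r₁ r₂ bl gr : Fin n
    r₁≢r₂  : r₁ ≢ r₂
    adj-r₁ : adj a r₁ ≡ true
    adj-r₂ : adj a r₂ ≡ true
    adj-bl : adj a bl ≡ true
    adj-gr : adj a gr ≡ true
    col-r₁ : col r₁ ≡ red
    col-r₂ : col r₂ ≡ red
    col-bl : col bl ≡ blue
    col-gr : col gr ≡ green
    cover  : ∀ u → adj a u ≡ true → u ∈ r₁ ∷ r₂ ∷ bl ∷ gr ∷ []

  nbrs-unique : Unique (r₁ ∷ r₂ ∷ bl ∷ gr ∷ [])
  nbrs-unique =
    (r₁≢r₂ ∷ colour-≢ col col-r₁ col-bl (λ ()) ∷ colour-≢ col col-r₁ col-gr (λ ()) ∷ []) ∷
    (colour-≢ col col-r₂ col-bl (λ ()) ∷ colour-≢ col col-r₂ col-gr (λ ()) ∷ []) ∷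
    (colour-≢ col col-bl col-gr (λ ()) ∷ []) ∷ [] ∷ []

  count-within-nbrs : (P : Fin n → Bool) → (∀ u → P u ≡ true → adj a u ≡ true) →
    count P ≡ ind (P r₁) + (ind (P r₂) + (ind (P bl) + (ind (P gr) + 0)))
  count-within-nbrs P P⊆N = count-support nbrs-unique (λ u Pu → cover u (P⊆N u Pu))

  count-nbrs : (C : Fin n → Bool) →
    count (λ u → C u ∧ adj a u) ≡ (ind (C r₁) + ind (C r₂)) + (ind (C bl) + ind (C gr))
  count-nbrs C
    rewrite count-within-nbrs (λ u → C u ∧ adj a u) (λ u e → proj₂ (∧-true e))
          | adj-r₁ | adj-r₂ | adj-bl | adj-gr
          | ∧-identityʳ (C r₁) | ∧-identityʳ (C r₂) | ∧-identityʳ (C bl) | ∧-identityʳ (C gr)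
          | +-identityʳ (ind (C gr)) = sym (+-assoc (ind (C r₁)) (ind (C r₂)) _)

  count-red-nbrs : (C : Fin n → Bool) →
    count (λ u → C u ∧ adj a u ∧ (col u ==c red)) ≡ ind (C r₁) + ind (C r₂)
  count-red-nbrs C
    rewrite count-within-nbrs (λ u → C u ∧ adj a u ∧ (col u ==c red)) (λ u e → proj₁ (∧-true (proj₂ (∧-true {C u} e))))
          | adj-r₁ | adj-r₂ | adj-bl | adj-gr | col-r₁ | col-r₂ | col-bl | col-gr
          | ∧-identityʳ (C r₁) | ∧-identityʳ (C r₂) | ∧-zeroʳ (C bl) | ∧-zeroʳ (C gr)
          | +-identityʳ (ind (C r₂)) = refl

  twoNbrsOneRed⇔ : (C : Fin n → Bool) →
    TwoNbrsOneRed adj col a C ⇔ (ind (C r₁) + ind (C r₂) ≡ 1 × ind (C bl) + ind (C gr) ≡ 1)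
  twoNbrsOneRed⇔ C rewrite count-nbrs C | count-red-nbrs C = mk⇔ to from
    where
    to : ∀ {p q} → p + q ≡ 2 × p ≡ 1 → p ≡ 1 × q ≡ 1
    to {q = q} (total , reds) = reds , +-cancelˡ-≡ 1 q 1 (trans (cong (_+ q) (sym reds)) total)
    from : ∀ {p q} → p ≡ 1 × q ≡ 1 → p + q ≡ 2 × p ≡ 1
    from (refl , refl) = refl , refl

neighbourhood : ∀ {n} {adj : Adj n} {col : Fin n → Colour} → ClassA adj col → ∀ a → Neighbourhood adj col a
neighbourhood {adj = adj} {col} A a
  with count≡2⇒two (ClassA.redNbrs A a) | count≡1⇒unique (ClassA.blueNbrs A a) | count≡1⇒unique (ClassA.greenNbrs A a)
... | x , y , x≢y , Rx , Ry , only-xy | b , Bb , only-b | g , Gg , only-g = record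
  { r₁ = x ; r₂ = y ; bl = b ; gr = g ; r₁≢r₂ = x≢y
  ; adj-r₁ = proj₁ (∧-true Rx) ; adj-r₂ = proj₁ (∧-true Ry)
  ; adj-bl = proj₁ (∧-true Bb) ; adj-gr = proj₁ (∧-true Gg)
  ; col-r₁ = ==c⇒≡ (proj₂ (∧-true Rx)) ; col-r₂ = ==c⇒≡ (proj₂ (∧-true Ry))
  ; col-bl = ==c⇒≡ (proj₂ (∧-true Bb)) ; col-gr = ==c⇒≡ (proj₂ (∧-true Gg))
  ; cover = cover }
  where
  cover : ∀ u → adj a u ≡ true → u ∈ x ∷ y ∷ b ∷ g ∷ []
  cover u a-u with col u in cu
  ... | red   with only-xy u (cong₂ _∧_ a-u (cong (_==c red) cu))
  ...   | inj₁ u≡x = here u≡x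
  ...   | inj₂ u≡y = there (here u≡y)
  cover u a-u | blue  = there (there (here (only-b u (cong₂ _∧_ a-u (cong (_==c blue) cu)))))
  cover u a-u | green = there (there (there (here (only-g u (cong₂ _∧_ a-u (cong (_==c green) cu))))))

∸2≢∸1 : ∀ {r} → 2 ≤ r → r ∸ 2 ≢ r ∸ 1
∸2≢∸1 (s≤s (s≤s _)) e = 1+n≢n (sym e)

module Ports {r : ℕ} (2≤r : 2 ≤ r) {nB : ℕ} {adjB : Adj nB} {vtx : Colour → Fin nB}
             (B* : ClassBStar r adjB vtx) where

  open ClassBStar B* using (classB; cuts)
  open ClassB classB

  rd bu gn : Fin nB
  rd = vtx red
  bu = vtx blue
  gn = vtx green

  rd≢ : ∀ {v} → deg adjB v ≡ r ∸ 1 → rd ≢ v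
  rd≢ deg-v e = ∸2≢∸1 2≤r (trans (sym degRed) (trans (cong (deg adjB) e) deg-v))

  rd≢bu : rd ≢ bu
  rd≢bu = rd≢ degBlue

  rd≢gn : rd ≢ gn
  rd≢gn = rd≢ degGreen

  ports-unique : Unique (rd ∷ bu ∷ gn ∷ [])
  ports-unique = (rd≢bu ∷ rd≢gn ∷ []) ∷ (blue≢green ∷ []) ∷ [] ∷ []

  -- Σ_{v ∈ K} (r - deg v), the quantity bounded in the definition of ℬ*.
  portWeight : (Fin nB → Bool) → ℕ
  portWeight K = (if K rd then 2 else 0) + (ind (K bu) + ind (K gn))

  portWeight-mono : ∀ {K K′} → (∀ v → K v ≡ true → K′ v ≡ true) → portWeight K ≤ portWeight K′
  portWeight-mono K⊆K′ = +-mono-≤ (if-mono 2 (K⊆K′ rd)) (+-mono-≤ (if-mono 1 (K⊆K′ bu)) (if-mono 1 (K⊆K′ gn)))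
    where
    if-mono : ∀ {a b} m → (a ≡ true → b ≡ true) → (if a then m else 0) ≤ (if b then m else 0)
    if-mono {false} m _ = z≤n
    if-mono {true}  m a⇒b rewrite a⇒b refl = ≤-refl

  off-ports : ∀ {v} → v ∉ rd ∷ bu ∷ gn ∷ [] → ∀ c → v ≢ vtx c
  off-ports v∉ red   e = v∉ (here e)
  off-ports v∉ blue  e = v∉ (there (here e))
  off-ports v∉ green e = v∉ (there (there (here e)))

  deficit-vanishes : ∀ (K : Fin nB → Bool) v → v ∉ rd ∷ bu ∷ gn ∷ [] → (if K v then r ∸ deg adjB v else 0) ≡ 0
  deficit-vanishes K v v∉ rewrite degOther v (off-ports v∉) | n∸n≡0 r with K v
  ... | true  = refl
  ... | false = refl

  deficit-sum : ∀ (K : Fin nB → Bool) → sumFin (λ v → if K v then r ∸ deg adjB v else 0) ≡ portWeight K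
  deficit-sum K
    rewrite sumFin-support (λ v → if K v then r ∸ deg adjB v else 0) ports-unique (deficit-vanishes K)
          | degRed | degBlue | degGreen | m∸[m∸n]≡n 2≤r | m∸[m∸n]≡n (≤-trans (s≤s z≤n) 2≤r)
          | +-identityʳ (if K gn then 1 else 0) = refl

  complement-weight : ∀ (W : Fin nB → Bool) → 3 ∸ count W ≤ portWeight (λ v → not (W v))
  complement-weight W = ≤-trans (∸-monoʳ-≤ 3 (sum-points≤sumFin (λ v → ind (W v)) ports-unique))
                                (bound (W rd) (W bu) (W gn))
    where
    bound : ∀ x y z → 3 ∸ (ind x + (ind y + (ind z + 0))) ≤ (if not x then 2 else 0) + (ind (not y) + ind (not z))
    bound true  true  true  = ≤ᵇ⇒≤ _ _ _
    bound true  true  false = ≤ᵇ⇒≤ _ _ _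
    bound true  false true  = ≤ᵇ⇒≤ _ _ _
    bound true  false false = ≤ᵇ⇒≤ _ _ _
    bound false true  true  = ≤ᵇ⇒≤ _ _ _
    bound false true  false = ≤ᵇ⇒≤ _ _ _
    bound false false true  = ≤ᵇ⇒≤ _ _ _
    bound false false false = ≤ᵇ⇒≤ _ _ _

  module _ {W : Fin nB → Bool} {b : Fin nB} (b∉W : W b ≡ false) where

    open Reach adjB W b

    -- Either W is a cut and ℬ* applies, or the component is all of B - W.
    port-weight-bound : count W ≤ 2 → 3 ∸ count W ≤ portWeight reach
    port-weight-bound c≤2 with implies-or-counterexample W false reach
    ... | inj₁ all-reached = ≤-trans (complement-weight W) (portWeight-mono λ v e → all-reached v (not-true e))
    ... | inj₂ (v , v∉W , unreached) = cut-bound c≤2 refl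
      where
      cut : IsCut adjB W
      cut = b , v , b∉W , v∉W , λ p → true≢false (reach-complete p) unreached
      component : IsComponent adjB W reach
      component = reach-isComponent (IsSimple.sym simple) b∉W
      cut-bound : ∀ {h} → h ≤ 2 → count W ≡ h → 3 ∸ h ≤ portWeight reach
      cut-bound {0} _ c = ⊥-elim (true≢false (reach-complete (path-weaken (λ x _ → count≡0⇒false c x)
                                                                 (proj₂ connected b v refl refl))) unreached)
      cut-bound {1} _ c = subst (2 ≤_) (deficit-sum reach) (cuts 1 W (inj₁ refl) c cut reach component)
      cut-bound {2} _ c = subst (1 ≤_) (deficit-sum reach) (cuts 2 W (inj₂ refl) c cut reach component)
      cut-bound {suc (suc (suc _))} (s≤s (s≤s ())) _

    reaches-port : count W ≤ 2 → ∃ λ c → Path adjB W b (vtx c)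
    reaches-port c≤2 with weight≥1 (reach rd) (reach bu) (reach gn) (≤-trans (∸-monoʳ-≤ 3 c≤2) (port-weight-bound c≤2))
      where
      weight≥1 : ∀ x y z → 1 ≤ (if x then 2 else 0) + (ind y + ind z) → x ≡ true ⊎ y ≡ true ⊎ z ≡ true
      weight≥1 true  _     _     _ = inj₁ refl
      weight≥1 false true  _     _ = inj₂ (inj₁ refl)
      weight≥1 false false true  _ = inj₂ (inj₂ refl)
    ... | inj₁ r-rd        = red   , reach-sound rd r-rd
    ... | inj₂ (inj₁ r-bu) = blue  , reach-sound bu r-bu
    ... | inj₂ (inj₂ r-gn) = green , reach-sound gn r-gn

    reaches-red-or-blue-green : count W ≤ 1 → Path adjB W b rd ⊎ (Path adjB W b bu × Path adjB W b gn)
    reaches-red-or-blue-green c≤1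
      with weight≥2 (reach rd) (reach bu) (reach gn)
                    (≤-trans (∸-monoʳ-≤ 3 c≤1) (port-weight-bound (≤-trans c≤1 (s≤s z≤n))))
      where
      weight≥2 : ∀ x y z → 2 ≤ (if x then 2 else 0) + (ind y + ind z) → x ≡ true ⊎ (y ≡ true × z ≡ true)
      weight≥2 true  _    _    _ = inj₁ refl
      weight≥2 false true true _ = inj₂ (refl , refl)
      weight≥2 false true false (s≤s ())
      weight≥2 false false true  (s≤s ())
      weight≥2 false false false ()
    ... | inj₁ r-rd            = inj₁ (reach-sound rd r-rd)
    ... | inj₂ (r-bu , r-gn) = inj₂ (reach-sound bu r-bu , reach-sound gn r-gn)

module Connectivity {r : ℕ} (2≤r : 2 ≤ r) {nA nB : ℕ} {adjA : Adj nA} {colA : Fin nA → Colour}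
  {adjB : Adj nB} {vtx : Colour → Fin nB} {f : Fin nA → Fin nB}
  (A : ClassA adjA colA) (B* : ClassBStar r adjB vtx) (f-colour : ∀ a → f a ≡ vtx (colA a)) where

  open Sierpinski adjA adjB f
  open Ports 2≤r B*
  open ClassB (ClassBStar.classB B*) using (connected; blue≢green) renaming (simple to simpleB)

  symA : ∀ x y → adjA x y ≡ adjA y x
  symA = IsSimple.sym (ClassA.simple A)

  symP : ∀ x y → adjP x y ≡ adjP y x
  symP = adjP-sym symA (IsSimple.sym simpleB)

  adj⇒≢ : ∀ {a g} → adjA a g ≡ true → g ≢ a
  adj⇒≢ {a} e refl = true≢false e (IsSimple.irrefl (ClassA.simple A) a)

  module Nbhd (a : Fin nA) = Neighbourhood (neighbourhood A a)

  f-by-colour : ∀ {g c} → colA g ≡ c → f g ≡ vtx c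
  f-by-colour {g} e = trans (f-colour g) (cong vtx e)

  module Backward where

    nbr-of-colour : ∀ a c → ∃ λ g → adjA a g ≡ true × f g ≡ vtx c
    nbr-of-colour a red   = Nbhd.r₁ a , Nbhd.adj-r₁ a , f-by-colour (Nbhd.col-r₁ a)
    nbr-of-colour a blue  = Nbhd.bl a , Nbhd.adj-bl a , f-by-colour (Nbhd.col-bl a)
    nbr-of-colour a green = Nbhd.gr a , Nbhd.adj-gr a , f-by-colour (Nbhd.col-gr a)

    module Removed (S : V → Bool) (s₁ s₂ : V) (S⊆s₁s₂ : ∀ x → S x ≡ true → x ≡ s₁ ⊎ x ≡ s₂) where

      a₁ a₂ : Fin nA
      a₁ = prA s₁
      a₂ = prA s₂

      Bad : Fin nA → Bool
      Bad = pair a₁ a₂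

      removed : Fin nA → Fin nB → Bool
      removed a b = S (pt a b)

      in-S : ∀ {a b} → S (pt a b) ≡ true → (a ≡ a₁ × b ≡ prB s₁) ⊎ (a ≡ a₂ × b ≡ prB s₂)
      in-S {a} {b} e with S⊆s₁s₂ (pt a b) e
      ... | inj₁ is-s₁ = inj₁ (pt-injective (trans is-s₁ (sym (pt-prA-prB s₁))))
      ... | inj₂ is-s₂ = inj₂ (pt-injective (trans is-s₂ (sym (pt-prA-prB s₂))))

      good-intact : ∀ {g} → Bad g ≡ false → ∀ b → S (pt g b) ≡ false
      good-intact {g} good b with S (pt g b) in e
      ... | false = refl
      ... | true with in-S e
      ...   | inj₁ (g≡a₁ , _) = ⊥-elim (pair-false⇒≢ˡ good g≡a₁)
      ...   | inj₂ (g≡a₂ , _) = ⊥-elim (pair-false⇒≢ʳ good g≡a₂)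

      removed≤2 : ∀ a → count (removed a) ≤ 2
      removed≤2 a = count≤length (prB s₁ ∷ prB s₂ ∷ []) λ b e → case (in-S e)
        where
        case : ∀ {b} → (a ≡ a₁ × b ≡ prB s₁) ⊎ (a ≡ a₂ × b ≡ prB s₂) → b ∈ prB s₁ ∷ prB s₂ ∷ []
        case (inj₁ (_ , b≡)) = here b≡
        case (inj₂ (_ , b≡)) = there (here b≡)

      removed≤1 : a₁ ≢ a₂ → ∀ a → count (removed a) ≤ 1
      removed≤1 a₁≢a₂ a with a ≟ a₁
      ... | yes a≡a₁ = count≤length (prB s₁ ∷ []) λ b e →
        here ([ proj₂ , (λ (a≡a₂ , _) → ⊥-elim (a₁≢a₂ (trans (sym a≡a₁) a≡a₂))) ]′ (in-S e))
      ... | no  a≢a₁ = count≤length (prB s₂ ∷ []) λ b e →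
        here ([ (λ (a≡a₁ , _) → ⊥-elim (a≢a₁ a≡a₁)) , proj₂ ]′ (in-S e))

      good-path : ∀ {g g′} → Path adjA Bad g g′ → Bad g ≡ false → ∀ b b′ → Path adjP S (pt g b) (pt g′ b′)
      good-path {g} here good b b′ = copy-path S g (intact-copy good b b′)
        where
        intact-copy : ∀ {g} → Bad g ≡ false → ∀ b b′ → Path adjB (removed g) b b′
        intact-copy good b b′ = path-weaken (λ c _ → good-intact good c) (proj₂ connected b b′ refl refl)
      good-path {g} (step {v = h} a h-good p) good b b′ =
        path-++ (good-path here good b (f h))
                (step (link-edge a) (good-intact h-good (f g)) (good-path p h-good (f g) b′))

      exit : ∀ {a b g} → Path adjB (removed a) b (f g) → adjA a g ≡ true → Bad g ≡ false →
             Path adjP S (pt a b) (pt g (f a))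
      exit {a} {g = g} p a-g good = path-snoc (copy-path S a p) (link-edge a-g) (good-intact good (f a))

      Escape : Fin nA → Fin nB → Set
      Escape a b = ∃ λ g → Bad g ≡ false × Path adjP S (pt a b) (pt g (f a))

      sole-bad-nbrs-good : a₁ ≡ a₂ → ∀ {a g} → Bad a ≡ true → adjA a g ≡ true → Bad g ≡ false
      sole-bad-nbrs-good a₁≡a₂ {a} {g} bad a-g with Bad g in g-bad
      ... | false = refl
      ... | true  = ⊥-elim (adj⇒≢ a-g (same (pair-true {a = a₁} {a₂} g-bad) (pair-true {a = a₁} {a₂} bad)))
        where
        same : g ≡ a₁ ⊎ g ≡ a₂ → a ≡ a₁ ⊎ a ≡ a₂ → g ≡ a
        same (inj₁ g≡) (inj₁ a≡) = trans g≡ (sym a≡)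
        same (inj₁ g≡) (inj₂ a≡) = trans g≡ (trans a₁≡a₂ (sym a≡))
        same (inj₂ g≡) (inj₁ a≡) = trans g≡ (trans (sym a₁≡a₂) (sym a≡))
        same (inj₂ g≡) (inj₂ a≡) = trans g≡ (sym a≡)

      escape-via : ∀ {a b g₁ g₂} → Bad a ≡ true → g₁ ≢ g₂ → adjA a g₁ ≡ true → adjA a g₂ ≡ true →
                   Path adjB (removed a) b (f g₁) → Path adjB (removed a) b (f g₂) → Escape a b
      escape-via {g₁ = g₁} {g₂} bad g₁≢g₂ a-g₁ a-g₂ p₁ p₂ with Bad g₁ in bad₁ | Bad g₂ in bad₂
      ... | false | _     = g₁ , bad₁ , exit p₁ a-g₁ bad₁
      ... | true  | false = g₂ , bad₂ , exit p₂ a-g₂ bad₂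
      ... | true  | true  = ⊥-elim (g₁≢g₂ (pair-pigeonhole {a = a₁} {a₂} bad₁ bad₂ bad (adj⇒≢ a-g₁) (adj⇒≢ a-g₂)))

      escape : ∀ {a b} → Bad a ≡ true → S (pt a b) ≡ false → Escape a b
      escape {a} {b} bad b∉ with a₁ ≟ a₂
      ... | yes a₁≡a₂ =
        let c , to-port = reaches-port b∉ (removed≤2 a)
            g , a-g , f-g = nbr-of-colour a c
            good = sole-bad-nbrs-good a₁≡a₂ bad a-g
        in g , good , exit (subst (Path adjB (removed a) b) (sym f-g) to-port) a-g good
      ... | no a₁≢a₂ with reaches-red-or-blue-green b∉ (removed≤1 a₁≢a₂ a)
      ...   | inj₁ to-rd = escape-via bad (Nbhd.r₁≢r₂ a) (Nbhd.adj-r₁ a) (Nbhd.adj-r₂ a)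
                             (subst (Path adjB (removed a) b) (sym (f-by-colour (Nbhd.col-r₁ a))) to-rd)
                             (subst (Path adjB (removed a) b) (sym (f-by-colour (Nbhd.col-r₂ a))) to-rd)
      ...   | inj₂ (to-bu , to-gn) =
        escape-via bad (colour-≢ colA (Nbhd.col-bl a) (Nbhd.col-gr a) (λ ())) (Nbhd.adj-bl a) (Nbhd.adj-gr a)
                   (subst (Path adjB (removed a) b) (sym (f-by-colour (Nbhd.col-bl a))) to-bu)
                   (subst (Path adjB (removed a) b) (sym (f-by-colour (Nbhd.col-gr a))) to-gn)

      through-copy : ∀ {s e₁ e₂} → adjA s e₁ ≡ true → adjA s e₂ ≡ true → Bad e₁ ≡ false →
                     S (pt s (f e₂)) ≡ false → Path adjB (removed s) (f e₂) (f e₁) →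
                     Path adjP S (pt e₂ (f s)) (pt e₁ (f s))
      through-copy s-e₁ s-e₂ good₁ entry p = step (link-edge (trans (symA _ _) s-e₂)) entry (exit p s-e₁ good₁)

      red-member : ∀ {s C} → TwoNbrsOneRed adjA colA s C → ∃ λ e → adjA s e ≡ true × f e ≡ rd × C e ≡ true
      red-member {s} {C} two with ind+ind≡1 (proj₁ (Equivalence.to (Nbhd.twoNbrsOneRed⇔ s C) two))
      ... | inj₁ C-r₁ = Nbhd.r₁ s , Nbhd.adj-r₁ s , f-by-colour (Nbhd.col-r₁ s) , C-r₁
      ... | inj₂ C-r₂ = Nbhd.r₂ s , Nbhd.adj-r₂ s , f-by-colour (Nbhd.col-r₂ s) , C-r₂

      nonred-member : ∀ {s C} → TwoNbrsOneRed adjA colA s C →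
                      ∃ λ e → adjA s e ≡ true × (f e ≡ bu ⊎ f e ≡ gn) × C e ≡ true
      nonred-member {s} {C} two with ind+ind≡1 (proj₂ (Equivalence.to (Nbhd.twoNbrsOneRed⇔ s C) two))
      ... | inj₁ C-bl = Nbhd.bl s , Nbhd.adj-bl s , inj₁ (f-by-colour (Nbhd.col-bl s)) , C-bl
      ... | inj₂ C-gr = Nbhd.gr s , Nbhd.adj-gr s , inj₂ (f-by-colour (Nbhd.col-gr s)) , C-gr

      -- If (s , rd) is removed, it is the only removed vertex of its copy.
      nonred-ports-joined : ∀ {s} → a₁ ≢ a₂ → removed s rd ≡ true →
        ∀ {b b′} → b ≡ bu ⊎ b ≡ gn → b′ ≡ bu ⊎ b′ ≡ gn → removed s b ≡ false × Path adjB (removed s) b b′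
      nonred-ports-joined {s} a₁≢a₂ rd-removed = joined
        where
        c≤1 = removed≤1 a₁≢a₂ s
        intact : ∀ {c} → rd ≢ c → removed s c ≡ false
        intact {c} rd≢c with removed s c in c-removed
        ... | false = refl
        ... | true  = ⊥-elim (rd≢c (count≤1⇒unique c≤1 rd-removed c-removed))
        bu∉ = intact rd≢bu
        gn∉ = intact rd≢gn
        bu→gn : Path adjB (removed s) bu gn
        bu→gn with reaches-red-or-blue-green bu∉ c≤1
        ... | inj₁ to-rd         = ⊥-elim (true≢false rd-removed (path-avoids to-rd bu∉))
        ... | inj₂ (_ , to-gn) = to-gn
        joined : ∀ {b b′} → b ≡ bu ⊎ b ≡ gn → b′ ≡ bu ⊎ b′ ≡ gn → removed s b ≡ false × Path adjB (removed s) b b′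
        joined (inj₁ refl) (inj₁ refl) = bu∉ , here
        joined (inj₁ refl) (inj₂ refl) = bu∉ , bu→gn
        joined (inj₂ refl) (inj₁ refl) = gn∉ , path-reverse (IsSimple.sym simpleB) bu∉ bu→gn
        joined (inj₂ refl) (inj₂ refl) = gn∉ , here

      Bridge : Fin nA → (Fin nA → Bool) → (Fin nA → Bool) → Set
      Bridge s C₁ C₂ = ∃₂ λ e₁ e₂ → C₁ e₁ ≡ true × C₂ e₂ ≡ true × Path adjP S (pt e₂ (f s)) (pt e₁ (f s))

      bridge : ∀ {s C₁ C₂} → a₁ ≢ a₂ → (∀ e → C₁ e ≡ true → Bad e ≡ false) →
               TwoNbrsOneRed adjA colA s C₁ → TwoNbrsOneRed adjA colA s C₂ → Bridge s C₁ C₂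
      bridge {s} a₁≢a₂ C₁-good two₁ two₂ with removed s rd in rd-removed
      ... | false =
        let e₁ , s-e₁ , f-e₁ , in₁ = red-member two₁
            e₂ , s-e₂ , f-e₂ , in₂ = red-member two₂
        in e₁ , e₂ , in₁ , in₂ ,
           through-copy s-e₁ s-e₂ (C₁-good e₁ in₁) (subst (λ b → removed s b ≡ false) (sym f-e₂) rd-removed)
                        (subst₂ (Path adjB (removed s)) (sym f-e₂) (sym f-e₁) here)
      ... | true =
        let e₁ , s-e₁ , f-e₁ , in₁ = nonred-member two₁
            e₂ , s-e₂ , f-e₂ , in₂ = nonred-member two₂
            entry , p = nonred-ports-joined a₁≢a₂ rd-removed f-e₂ f-e₁
        in e₁ , e₂ , in₁ , in₂ , through-copy s-e₁ s-e₂ (C₁-good e₁ in₁) entry p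

      via-good-hub : (hub : V) → (∀ g → Bad g ≡ false → ∀ b → Path adjP S (pt g b) hub) → ConnAvoid adjP S
      via-good-hub hub from-good = connected-via-hub symP hub λ x x∉ →
        subst (λ y → Path adjP S y hub) (pt-prA-prB x)
              (from (prA x) (prB x) (subst (λ y → S y ≡ false) (sym (pt-prA-prB x)) x∉))
        where
        from : ∀ a b → S (pt a b) ≡ false → Path adjP S (pt a b) hub
        from a b b∉ with Bad a in a-bad
        ... | false = from-good a a-bad b
        ... | true  = let g , good , p = escape a-bad b∉ in path-++ p (from-good g good (f a))

      Bad≤2 : count Bad ≤ 2
      Bad≤2 = count≤length (a₁ ∷ a₂ ∷ []) λ x x-bad → case (pair-true {a = a₁} {a₂} x-bad)
        where
        case : ∀ {x} → x ≡ a₁ ⊎ x ≡ a₂ → x ∈ a₁ ∷ a₂ ∷ []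
        case (inj₁ e) = here e
        case (inj₂ e) = there (here e)

      across-cut : Sharp adjA colA → a₁ ≢ a₂ → IsCut adjA Bad → ConnAvoid adjP S
      across-cut sharp a₁≢a₂ cut with sharp a₁ a₂ a₁≢a₂ cut
      ... | C₁ , C₂ , comp₁ , comp₂ , _ , cover , twos = via-good-hub (pt c₁ (f c₁)) from-good
        where
        module K₁ = IsComponent comp₁
        module K₂ = IsComponent comp₂
        c₁ = proj₁ K₁.nonempty
        c₁-in = proj₂ K₁.nonempty
        crossing : ∃ λ s → Bridge s C₁ C₂
        crossing = [ (λ (two₁ , two₂) → a₁ , bridge a₁≢a₂ K₁.avoids two₁ two₂)
                   , (λ (two₁ , two₂) → a₂ , bridge a₁≢a₂ K₁.avoids two₁ two₂) ]′ twos
        from-good : ∀ g → Bad g ≡ false → ∀ b → Path adjP S (pt g b) (pt c₁ (f c₁))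
        from-good g good b with cover g good | crossing
        ... | inj₁ in₁ | _ = good-path (K₁.conn g c₁ in₁ c₁-in) good b (f c₁)
        ... | inj₂ in₂ | s , e₁ , e₂ , e₁-in , e₂-in , e₂→e₁ =
          path-++ (good-path (K₂.conn g e₂ in₂ e₂-in) good b (f s))
                  (path-++ e₂→e₁ (good-path (K₁.conn e₁ c₁ e₁-in c₁-in) (K₁.avoids e₁ e₁-in) (f s) (f c₁)))

      removal-connected : Sharp adjA colA → KConnected 2 adjA → ConnAvoid adjP S
      removal-connected sharp (2<nA , A-2conn) with exists-outside (≤-<-trans Bad≤2 2<nA)
      ... | g₀ , g₀-good with implies-or-counterexample Bad false (Reach.reach adjA Bad g₀)
      ...   | inj₁ all-reached = via-good-hub (pt g₀ (f g₀)) λ g good b →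
        good-path (path-reverse symA g₀-good (Reach.reach-sound adjA Bad g₀ g (all-reached g good))) good b (f g₀)
      ...   | inj₂ (g′ , g′-good , unreached) = across-cut sharp a₁≢a₂ cut
        where
        separated : ¬ Path adjA Bad g₀ g′
        separated p = true≢false (Reach.reach-complete adjA Bad g₀ p) unreached
        cut : IsCut adjA Bad
        cut = g₀ , g′ , g₀-good , g′-good , separated
        a₁≢a₂ : a₁ ≢ a₂
        a₁≢a₂ a₁≡a₂ = separated (A-2conn Bad (s≤s Bad≤1) g₀ g′ g₀-good g′-good)
          where
          Bad≤1 : count Bad ≤ 1
          Bad≤1 = count≤length (a₁ ∷ []) λ x x-bad →
            here ([ id , (λ x≡a₂ → trans x≡a₂ (sym a₁≡a₂)) ]′ (pair-true {a = a₁} {a₂} x-bad))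

    backward : Sharp adjA colA → KConnected 2 adjA → KConnected 3 adjP
    backward sharp A-2conn@(2<nA , _) = 3<size , λ S c<3 →
      let s₁ , s₂ , S⊆s₁s₂ = count≤2⇒covered (≤-pred c<3) (pt a₀ rd)
      in Removed.removal-connected S s₁ s₂ S⊆s₁s₂ sharp A-2conn
      where
      a₀ : Fin nA
      a₀ = fromℕ< (proj₁ (ClassA.connected A))
      2≤nB : 2 ≤ nB
      2≤nB = ≤-trans (two≤count {P = λ _ → true} blue≢green refl refl) (count≤n _)
      3<size : 3 < nA * nB
      3<size = ≤-trans (s≤s (s≤s (s≤s (s≤s z≤n)))) (*-mono-≤ {3} {nA} {2} {nB} 2<nA 2≤nB)

  module Forward (P-3conn : KConnected 3 adjP) where

    attach : (Fin nA → Bool) → Fin nA → ℕ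
    attach Z a = count (λ c → Z c ∧ adjA a c)

    -- Within a copy nothing changes; the copies over Z can only be left along the
    -- links of A-edges leaving Z, and T blocks each of them.
    no-small-separator : (T : V → Bool) → count T ≤ 2 → (Z : Fin nA → Bool) →
      (∀ c c′ → Z c ≡ true → Z c′ ≡ false → adjA c c′ ≡ true →
                T (pt c (f c′)) ≡ true ⊎ T (pt c′ (f c)) ≡ true) →
      ∀ {u v b b′} → Z u ≡ true → T (pt u b) ≡ false → Z v ≡ false → T (pt v b′) ≡ false → ⊥
    no-small-separator T T≤2 Z crossings {u} {v} {b} {b′} Zu u∉ Zv v∉ =
      true≢false (trans (sym (cong Z (prA-pt v b′)))
                        (path-stays (λ z → Z (prA z)) closed (trans (cong Z (prA-pt u b)) Zu) u∉
                                    (proj₂ P-3conn T (s≤s T≤2) (pt u b) (pt v b′) u∉ v∉)))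
                 Zv
      where
      reassemble : ∀ x {b} → prB x ≡ b → pt (prA x) b ≡ x
      reassemble x refl = pt-prA-prB x
      closed : ∀ z w → Z (prA z) ≡ true → T z ≡ false → adjP z w ≡ true → T w ≡ false → Z (prA w) ≡ true
      closed z w Zz z∉ e w∉ with adjP-cases z w e
      ... | inj₁ (same , _) = subst (λ a → Z a ≡ true) same Zz
      ... | inj₂ (a-edge , bz , bw) with Z (prA w) in Zw
      ...   | true  = refl
      ...   | false with crossings (prA z) (prA w) Zz Zw a-edge
      ...     | inj₁ Tz = ⊥-elim (true≢false (subst (λ x → T x ≡ true) (reassemble z bz) Tz) z∉)
      ...     | inj₂ Tw = ⊥-elim (true≢false (subst (λ x → T x ≡ true) (reassemble w bw) Tw) w∉)

    exists-≢ : (b : Fin nB) → ∃ λ b′ → b′ ≢ b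
    exists-≢ b with exists-outside {P = λ b′ → b′ ≡ᵇ b} (≤-<-trans single 2≤nB)
      where
      single : count (λ b′ → b′ ≡ᵇ b) ≤ 1
      single = count≤length (b ∷ []) λ b′ e → here (≡ᵇ⇒≡ e)
      2≤nB : 2 ≤ nB
      2≤nB = ≤-trans (two≤count {P = λ _ → true} blue≢green refl refl) (count≤n _)
    ... | b′ , b′≢b = b′ , λ e → true≢false (subst (λ z → z ≡ᵇ b ≡ true) (sym e) (≡ᵇ-refl b)) b′≢b

    4<nA : 4 < nA
    4<nA = let a = fromℕ< (proj₁ (ClassA.connected A)) in
      subst (_< nA) (ClassA.regular A a)
        (≤-trans (count-strict (λ _ _ → refl) a refl (IsSimple.irrefl (ClassA.simple A) a)) (≤-reflexive count-all))

    -- The (at most two) neighbours of a in Z are linked to the copy of a at port f a.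
    few-attachments : ∀ a (Z : Fin nA → Bool) → Z a ≡ false →
      (∀ c c′ → Z c ≡ true → adjA c c′ ≡ true → c′ ≢ a → Z c′ ≡ true) →
      attach Z a ≤ 2 → ∀ z → Z z ≡ true → ⊥
    few-attachments a Z Za closed Z≤2 z Zz with count≤2⇒covered Z≤2 z | exists-≢ (f a)
    ... | z₁ , z₂ , covered | b , b≢fa =
      no-small-separator T (count≤length (pt z₁ (f a) ∷ pt z₂ (f a) ∷ []) T⊆) Z crossings Zz (off-T z) Za (off-T a)
      where
      T : V → Bool
      T = pair (pt z₁ (f a)) (pt z₂ (f a))
      T⊆ : ∀ x → T x ≡ true → x ∈ pt z₁ (f a) ∷ pt z₂ (f a) ∷ []
      T⊆ x e = [ here , there ∘ here ]′ (pair-true e)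
      off-T : ∀ c → T (pt c b) ≡ false
      off-T c = pair-false (b≢fa ∘ proj₂ ∘ pt-injective) (b≢fa ∘ proj₂ ∘ pt-injective)
      crossings : ∀ c c′ → Z c ≡ true → Z c′ ≡ false → adjA c c′ ≡ true →
                  T (pt c (f c′)) ≡ true ⊎ T (pt c′ (f c)) ≡ true
      in-T : ∀ {c} → c ≡ z₁ ⊎ c ≡ z₂ → T (pt c (f a)) ≡ true
      in-T (inj₁ refl) = pair-inˡ (pt z₁ (f a)) (pt z₂ (f a))
      in-T (inj₂ refl) = pair-inʳ (pt z₁ (f a)) (pt z₂ (f a))
      crossings c c′ Zc Zc′ e with c′ ≟ a
      ... | no c′≢a  = ⊥-elim (true≢false (closed c c′ Zc e c′≢a) Zc′)
      ... | yes refl = inj₁ (in-T (covered c (cong₂ _∧_ Zc (trans (symA a c) e))))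

    module VertexRemoval (a u : Fin nA) (u≢a : u ≢ a) where

      open Reach adjA (λ x → x ≡ᵇ a) u public

      rest : Fin nA → Bool
      rest c = not (reach c) ∧ not (c ≡ᵇ a)

      reach-a : reach a ≡ false
      reach-a with reach a in e
      ... | false = refl
      ... | true  = ⊥-elim (true≢false (≡ᵇ-refl a) (reach-avoids (≢⇒≡ᵇ-false u≢a) a e))

      rest-a : rest a ≡ false
      rest-a rewrite ≡ᵇ-refl a = ∧-zeroʳ (not (reach a))

      reach-closed′ : ∀ c c′ → reach c ≡ true → adjA c c′ ≡ true → c′ ≢ a → reach c′ ≡ true
      reach-closed′ c c′ Rc e c′≢a = reach-closed c c′ Rc e (≢⇒≡ᵇ-false c′≢a)

      rest-closed : ∀ c c′ → rest c ≡ true → adjA c c′ ≡ true → c′ ≢ a → rest c′ ≡ true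
      rest-closed c c′ rest-c e c′≢a =
        let unreached , c≢a = ∧-true {not (reach c)} rest-c in
        cong₂ _∧_ (cong not (unreached-closed symA c c′ (not-true unreached) (not-true c≢a) e))
                  (cong not (≢⇒≡ᵇ-false c′≢a))

      attachments : attach reach a + attach rest a ≡ 4
      attachments = trans (cong₂ _+_ (count-cong λ c → ∧-comm (reach c) (adjA a c)) (count-cong outside))
                          (trans (sym (count-split (adjA a) reach)) (ClassA.regular A a))
        where
        outside : ∀ c → rest c ∧ adjA a c ≡ adjA a c ∧ not (reach c)
        outside c with adjA a c in e
        ... | false = ∧-zeroʳ (rest c)
        ... | true rewrite ≢⇒≡ᵇ-false (adj⇒≢ e) = trans (∧-identityʳ _) (∧-identityʳ _)

    vertex-removal-connected : ∀ a u v → u ≢ a → v ≢ a → Path adjA (λ x → x ≡ᵇ a) u v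
    vertex-removal-connected a u v u≢a v≢a with reach v in Rv | sum4⇒≤2 attachments
      where open VertexRemoval a u u≢a
    ... | true  | _         = VertexRemoval.reach-sound a u u≢a v Rv
    ... | false | inj₁ R≤2 =
      ⊥-elim (few-attachments a reach reach-a reach-closed′ R≤2 u reach-start)
      where open VertexRemoval a u u≢a
    ... | false | inj₂ D≤2 =
      ⊥-elim (few-attachments a rest rest-a rest-closed D≤2 v rest-v)
      where
      open VertexRemoval a u u≢a
      rest-v : rest v ≡ true
      rest-v rewrite Rv | ≢⇒≡ᵇ-false v≢a = refl

    A-2connected : KConnected 2 adjA
    A-2connected = ≤-trans (s≤s (s≤s (s≤s z≤n))) 4<nA , removal-connected
      where
      removal-connected : ∀ W → count W < 2 → ConnAvoid adjA W
      removal-connected W (s≤s W≤1) u v u∉ v∉ with count W in c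
      ... | 0 = path-weaken (λ x _ → count≡0⇒false c x) (proj₂ (ClassA.connected A) u v refl refl)
      ... | 1 with count≡1⇒unique c
      ...   | a , Wa , only-a = path-weaken outside (vertex-removal-connected a u v (≢a u∉) (≢a v∉))
        where
        ≢a : ∀ {x} → W x ≡ false → x ≢ a
        ≢a x∉ refl = true≢false Wa x∉
        outside : ∀ x → x ≡ᵇ a ≡ false → W x ≡ false
        outside x x≢a with W x in Wx
        ... | false = refl
        ... | true  = ⊥-elim (true≢false (subst (λ y → y ≡ᵇ a ≡ true) (sym (only-a x Wx)) (≡ᵇ-refl a)) x≢a)
      removal-connected W (s≤s W≤1) u v u∉ v∉ | suc (suc _) with s≤s () ← W≤1

    ThroughPort : Fin nA → (Fin nA → Bool) → Fin nB → Set
    ThroughPort a X q = ∀ c → adjA a c ≡ true → X c ≡ true → f c ≡ q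

    module _ (a : Fin nA) where

      open Nbhd a

      private
        through-port-from : ∀ Z q → (Z r₁ ≡ true → f r₁ ≡ q) → (Z r₂ ≡ true → f r₂ ≡ q) →
                    (Z bl ≡ true → f bl ≡ q) → (Z gr ≡ true → f gr ≡ q) → ThroughPort a Z q
        through-port-from Z q h₁ h₂ h₃ h₄ c e Zc with cover c e
        ... | here refl                         = h₁ Zc
        ... | there (here refl)                 = h₂ Zc
        ... | there (there (here refl))         = h₃ Zc
        ... | there (there (there (here refl))) = h₄ Zc

        excluded : ∀ {Z : Fin nA → Bool} {x} {A : Set} → Z x ≡ false → Z x ≡ true → A
        excluded Zx Zx′ = ⊥-elim (true≢false Zx′ Zx)

        through-rd : ∀ Z → Z bl ≡ false → Z gr ≡ false → ThroughPort a Z rd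
        through-rd Z Zb Zg =
          through-port-from Z rd (λ _ → f-by-colour col-r₁) (λ _ → f-by-colour col-r₂) (excluded {Z} Zb) (excluded {Z} Zg)

        through-bu : ∀ Z → Z r₁ ≡ false → Z r₂ ≡ false → Z gr ≡ false → ThroughPort a Z bu
        through-bu Z Z₁ Z₂ Zg =
          through-port-from Z bu (excluded {Z} Z₁) (excluded {Z} Z₂) (λ _ → f-by-colour col-bl) (excluded {Z} Zg)

        through-gn : ∀ Z → Z r₁ ≡ false → Z r₂ ≡ false → Z bl ≡ false → ThroughPort a Z gn
        through-gn Z Z₁ Z₂ Zb =
          through-port-from Z gn (excluded {Z} Z₁) (excluded {Z} Z₂) (excluded {Z} Zb) (λ _ → f-by-colour col-gr)

        two : ∀ Z {p q s t} → Z r₁ ≡ p → Z r₂ ≡ q → Z bl ≡ s → Z gr ≡ t →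
              ind p + ind q ≡ 1 → ind s + ind t ≡ 1 → TwoNbrsOneRed adjA colA a Z
        two Z refl refl refl refl reds others = Equivalence.from (twoNbrsOneRed⇔ Z) (reds , others)

      module _ (X Y : Fin nA → Bool) (split : ∀ c → adjA a c ≡ true → Y c ≡ not (X c)) where

        private
          opposite : ∀ {c b} → adjA a c ≡ true → X c ≡ b → Y c ≡ not b
          opposite {c} e Xc = trans (split c e) (cong not Xc)

          both : ∀ {p q s t} → X r₁ ≡ p → X r₂ ≡ q → X bl ≡ s → X gr ≡ t → ind p + ind q ≡ 1 → ind s + ind t ≡ 1 →
                 TwoNbrsOneRed adjA colA a X × TwoNbrsOneRed adjA colA a Y
          both {p} {q} {s} {t} x₁ x₂ xb xg reds others =
            two X x₁ x₂ xb xg reds others ,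
            two Y (opposite adj-r₁ x₁) (opposite adj-r₂ x₂) (opposite adj-bl xb) (opposite adj-gr xg)
                  (complement p q reds) (complement s t others)
            where
            complement : ∀ p q → ind p + ind q ≡ 1 → ind (not p) + ind (not q) ≡ 1
            complement true  false _ = refl
            complement false true  _ = refl

        sharp-or-through-port : (TwoNbrsOneRed adjA colA a X × TwoNbrsOneRed adjA colA a Y)
                              ⊎ ∃ λ q → ThroughPort a X q ⊎ ThroughPort a Y q
        sharp-or-through-port with X bl in xb | X gr in xg | X r₁ in x₁ | X r₂ in x₂
        ... | true  | true  | _     | _     = inj₂ (rd , inj₂ (through-rd Y (opposite adj-bl xb) (opposite adj-gr xg)))
        ... | false | false | _     | _     = inj₂ (rd , inj₁ (through-rd X xb xg))
        ... | true  | false | true  | true  =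
          inj₂ (gn , inj₂ (through-gn Y (opposite adj-r₁ x₁) (opposite adj-r₂ x₂) (opposite adj-bl xb)))
        ... | true  | false | false | false = inj₂ (bu , inj₁ (through-bu X x₁ x₂ xg))
        ... | false | true  | true  | true  =
          inj₂ (bu , inj₂ (through-bu Y (opposite adj-r₁ x₁) (opposite adj-r₂ x₂) (opposite adj-gr xg)))
        ... | false | true  | false | false = inj₂ (gn , inj₁ (through-gn X x₁ x₂ xb))
        ... | true  | false | true  | false = inj₁ (both x₁ x₂ xb xg refl refl)
        ... | true  | false | false | true  = inj₁ (both x₁ x₂ xb xg refl refl)
        ... | false | true  | true  | false = inj₁ (both x₁ x₂ xb xg refl refl)
        ... | false | true  | false | true  = inj₁ (both x₁ x₂ xb xg refl refl)

    attach≤4 : ∀ Z a → attach Z a ≤ 4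
    attach≤4 Z a = ≤-trans (count-mono λ c e → proj₂ (∧-true {Z c} e)) (≤-reflexive (ClassA.regular A a))

    attach-∨ : ∀ {X Y} a → (∀ c → X c ≡ true → Y c ≡ false) → attach X a + attach Y a ≡ attach (λ c → X c ∨ Y c) a
    attach-∨ {X} {Y} a disjoint = sym (trans (count-cong distrib) (count-∨ apart))
      where
      distrib : ∀ c → (X c ∨ Y c) ∧ adjA a c ≡ (X c ∧ adjA a c) ∨ (Y c ∧ adjA a c)
      distrib c = ∧-distribʳ-∨ (adjA a c) (X c) (Y c)
      apart : ∀ c → (X c ∧ adjA a c) ∧ (Y c ∧ adjA a c) ≡ false
      apart c with X c in Xc
      ... | false = refl
      ... | true rewrite disjoint c Xc = ∧-zeroʳ (adjA a c)

    module TwoCut (a₁ a₂ : Fin nA) (a₁≢a₂ : a₁ ≢ a₂) where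

      Bad : Fin nA → Bool
      Bad = pair a₁ a₂

      record Piece (C : Fin nA → Bool) : Set where
        field
          closed : ∀ c c′ → C c ≡ true → adjA c c′ ≡ true → Bad c′ ≡ false → C c′ ≡ true
          avoids : ∀ c → C c ≡ true → Bad c ≡ false

      component : Fin nA → Fin nA → Bool
      component = Reach.reach adjA Bad

      component-piece : ∀ {u} → Bad u ≡ false → Piece (component u)
      component-piece {u} u-good = record
        { closed = λ c c′ in-c e c′-good → Reach.reach-closed adjA Bad u c c′ in-c e c′-good
        ; avoids = Reach.reach-avoids adjA Bad u u-good }

      module CutAtPorts (q₁ q₂ : Fin nB) where

        T : V → Bool
        T = pair (pt a₁ q₁) (pt a₂ q₂)

        T≤2 : count T ≤ 2
        T≤2 = count≤length (pt a₁ q₁ ∷ pt a₂ q₂ ∷ []) λ x e → [ here , there ∘ here ]′ (pair-true e)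

        T-good : ∀ {c} b → Bad c ≡ false → T (pt c b) ≡ false
        T-good b good =
          pair-false (pair-false⇒≢ˡ good ∘ proj₁ ∘ pt-injective) (pair-false⇒≢ʳ good ∘ proj₁ ∘ pt-injective)

        T-port : ∀ {c c′} → c′ ≡ a₁ × f c ≡ q₁ ⊎ c′ ≡ a₂ × f c ≡ q₂ → T (pt c′ (f c)) ≡ true
        T-port (inj₁ (refl , fc)) = subst (λ q → T (pt a₁ q) ≡ true) (sym fc) (pair-inˡ (pt a₁ q₁) (pt a₂ q₂))
        T-port (inj₂ (refl , fc)) = subst (λ q → T (pt a₂ q) ≡ true) (sym fc) (pair-inʳ (pt a₁ q₁) (pt a₂ q₂))

        port-cut : ∀ {C u v} → Piece C → ThroughPort a₁ C q₁ → ThroughPort a₂ C q₂ →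
                   C u ≡ true → C v ≡ false → Bad v ≡ false → ⊥
        port-cut {C} {u} C-piece via₁ via₂ Cu Cv v-good =
          no-small-separator T T≤2 C crossings Cu (T-good q₁ (avoids u Cu)) Cv (T-good q₁ v-good)
          where
          open Piece C-piece
          crossings : ∀ c c′ → C c ≡ true → C c′ ≡ false → adjA c c′ ≡ true →
                      T (pt c (f c′)) ≡ true ⊎ T (pt c′ (f c)) ≡ true
          crossings c c′ Cc Cc′ e with Bad c′ in bad
          ... | false = ⊥-elim (true≢false (closed c c′ Cc e bad) Cc′)
          ... | true with pair-true {a = a₁} {a₂} {c′} bad
          ...   | inj₁ refl = inj₂ (T-port (inj₁ (refl , via₁ c (trans (symA a₁ c) e) Cc)))
          ...   | inj₂ refl = inj₂ (T-port (inj₂ (refl , via₂ c (trans (symA a₂ c) e) Cc)))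

        -- Here the copies over C and over a₂ are cut off together.
        port-cut-mixed : ∀ {C C′ u v} → Piece C → Piece C′ → (∀ c → C c ≡ true → C′ c ≡ false) →
                    (∀ c → Bad c ≡ false → C c ≡ true ⊎ C′ c ≡ true) → adjA a₁ a₂ ≡ false →
                    ThroughPort a₁ C q₁ → ThroughPort a₂ C′ q₂ → C u ≡ true → C′ v ≡ true → ⊥
        port-cut-mixed {C} {C′} {u} {v} C-piece C′-piece disjoint cover a₁≁a₂ via₁ via₂ Cu C′v =
          no-small-separator T T≤2 Z crossings (cong (_∨ _) Cu) (T-good q₁ (avoids u Cu))
                             Zv (T-good q₁ (Piece.avoids C′-piece v C′v))
          where
          open Piece C-piece
          Z : Fin nA → Bool
          Z c = C c ∨ c ≡ᵇ a₂
          Cv : C v ≡ false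
          Cv with C v in Cv
          ... | false = refl
          ... | true  = ⊥-elim (true≢false C′v (disjoint v Cv))
          Zv : Z v ≡ false
          Zv = cong₂ _∨_ Cv (≢⇒≡ᵇ-false (pair-false⇒≢ʳ {a = a₁} {a₂} {v} (Piece.avoids C′-piece v C′v)))
          crossings : ∀ c c′ → Z c ≡ true → Z c′ ≡ false → adjA c c′ ≡ true →
                      T (pt c (f c′)) ≡ true ⊎ T (pt c′ (f c)) ≡ true
          crossings c c′ Zc Zc′ e with ∨-true {C c} Zc
          ... | inj₁ Cc with Bad c′ in bad
          ...   | false = ⊥-elim (true≢false (closed c c′ Cc e bad) (∨-conicalˡ _ _ Zc′))
          ...   | true with pair-true {a = a₁} {a₂} {c′} bad
          ...     | inj₁ refl = inj₂ (T-port (inj₁ (refl , via₁ c (trans (symA a₁ c) e) Cc)))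
          ...     | inj₂ refl = ⊥-elim (true≢false (≡ᵇ-refl a₂) (∨-conicalʳ _ _ Zc′))
          crossings c c′ Zc Zc′ e | inj₂ c≡a₂ with ≡ᵇ⇒≡ c≡a₂
          ... | refl = inj₁ (subst (λ q → T (pt a₂ q) ≡ true) (sym (via₂ c′ e C′c′)) (pair-inʳ (pt a₁ q₁) (pt a₂ q₂)))
            where
            c′-good : Bad c′ ≡ false
            c′-good = pair-false
              (λ c′≡a₁ → true≢false (subst (λ x → adjA a₂ x ≡ true) c′≡a₁ e) (trans (symA a₂ a₁) a₁≁a₂))
              (λ c′≡a₂ → true≢false (≡ᵇ-refl a₂) (subst (λ x → x ≡ᵇ a₂ ≡ false) c′≡a₂ (∨-conicalʳ _ _ Zc′)))
            C′c′ : C′ c′ ≡ true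
            C′c′ = [ (λ Cc′ → ⊥-elim (true≢false Cc′ (∨-conicalˡ _ _ Zc′))) , id ]′ (cover c′ c′-good)

      module _ {C : Fin nA → Bool} (C-piece : Piece C) where

        open Piece C-piece

        outside-bad : ∀ {x} → Bad x ≡ true → C x ≡ false
        outside-bad {x} bad with C x in Cx
        ... | false = refl
        ... | true  = ⊥-elim (true≢false bad (avoids x Cx))

        -- A piece lies in A - a′, which is connected, so it must be joined to a.
        touches : ∀ {u a a′} → C u ≡ true → Bad a ≡ true → Bad a′ ≡ true → a ≢ a′ →
                  (∀ c → c ≢ a → c ≢ a′ → Bad c ≡ false) → 0 < attach C a
        touches {u} {a} {a′} Cu a-bad a′-bad a≢a′ good-else with attach C a in none
        ... | suc _ = s≤s z≤n
        ... | zero  = ⊥-elim (true≢false (path-stays C stays Cu u∉ u→a) (outside-bad a-bad))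
          where
          u∉ : u ≡ᵇ a′ ≡ false
          u∉ = ≢⇒≡ᵇ-false λ u≡a′ → true≢false (subst (λ x → Bad x ≡ true) (sym u≡a′) a′-bad) (avoids u Cu)
          u→a : Path adjA (λ x → x ≡ᵇ a′) u a
          u→a = proj₂ A-2connected (λ x → x ≡ᵇ a′) (s≤s (count≤length (a′ ∷ []) λ x e → here (≡ᵇ⇒≡ e)))
                  u a u∉ (≢⇒≡ᵇ-false a≢a′)
          stays : ∀ x y → C x ≡ true → x ≡ᵇ a′ ≡ false → adjA x y ≡ true → y ≡ᵇ a′ ≡ false → C y ≡ true
          stays x y Cx _ e y≢a′ with y ≟ a
          ... | yes refl = ⊥-elim (true≢false (cong₂ _∧_ Cx (trans (symA a x) e)) (count≡0⇒false none x))
          ... | no  y≢a  = closed x y Cx e (good-else y y≢a (≡ᵇ-false⇒≢ y≢a′))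

        even-attachments : 2 ∣ attach C a₁ + attach C a₂
        even-attachments =
          subst (2 ∣_) (trans (sumFin-cong pointwise) (sumFin-+ (λ v → ind (C v ∧ adjA a₁ v)) (λ v → ind (C v ∧ adjA a₂ v))))
          (boundary-even (ClassA.simple A) C λ v _ → subst (2 ∣_) (sym (ClassA.regular A v)) (divides 2 refl))
          where
          leaves : ∀ v → C v ≡ true → ∀ w → adjA v w ∧ not (C w) ≡ true → w ∈ a₁ ∷ a₂ ∷ []
          leaves v Cv w e with ∧-true {adjA v w} e | Bad w in bad
          ... | v-w , w∉C | false = ⊥-elim (true≢false (closed v w Cv v-w bad) (not-true w∉C))
          ... | _        | true  = [ here , there ∘ here ]′ (pair-true {a = a₁} {a₂} {w} bad)
          pointwise : ∀ v → (if C v then count (λ w → adjA v w ∧ not (C w)) else 0) ≡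
                            ind (C v ∧ adjA a₁ v) + ind (C v ∧ adjA a₂ v)
          pointwise v with C v in Cv
          ... | false = refl
          ... | true
            rewrite count-support {P = λ w → adjA v w ∧ not (C w)} ((a₁≢a₂ ∷ []) ∷ [] ∷ []) (leaves v Cv)
                  | outside-bad {a₁} (pair-inˡ a₁ a₂) | outside-bad {a₂} (pair-inʳ a₁ a₂)
                  | symA v a₁ | symA v a₂ | ∧-identityʳ (adjA a₁ v) | ∧-identityʳ (adjA a₂ v)
                  | +-identityʳ (ind (adjA a₂ v)) = refl

        single-attachment⇒through-port : ∀ {a} → attach C a ≡ 1 → ∃ λ q → ThroughPort a C q
        single-attachment⇒through-port one with count≡1⇒unique one
        ... | c₀ , _ , only = f c₀ , λ c a-c Cc → cong f (only c (cong₂ _∧_ Cc a-c))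

        attachments≥4 : ∀ {u v} → C u ≡ true → C v ≡ false → Bad v ≡ false → 4 ≤ attach C a₁ + attach C a₂
        attachments≥4 Cu Cv v-good
          with even-split (touches Cu (pair-inˡ a₁ a₂) (pair-inʳ a₁ a₂) a₁≢a₂ (λ c → pair-false))
                          (touches Cu (pair-inʳ a₁ a₂) (pair-inˡ a₁ a₂) (a₁≢a₂ ∘ sym) (λ c n₂ n₁ → pair-false n₁ n₂))
                          even-attachments
        ... | inj₂ four = four
        ... | inj₁ (one₁ , one₂) =
          let q₁ , via₁ = single-attachment⇒through-port one₁
              q₂ , via₂ = single-attachment⇒through-port one₂
          in ⊥-elim (CutAtPorts.port-cut q₁ q₂ C-piece via₁ via₂ Cu Cv v-good)

      unreached-sym : ∀ {s t} → Bad s ≡ false → Bad t ≡ false → component s t ≡ false → component t s ≡ false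
      unreached-sym {s} {t} s-good t-good unreached with component t s in reached
      ... | false = refl
      ... | true  = ⊥-elim (true≢false (Reach.reach-complete adjA Bad s
                      (path-reverse symA t-good (Reach.reach-sound adjA Bad t s reached))) unreached)

      components-disjoint : ∀ {s t} → Bad t ≡ false → component s t ≡ false →
                            ∀ c → component s c ≡ true → component t c ≡ false
      components-disjoint {s} {t} t-good unreached c in-s with component t c in in-t
      ... | false = refl
      ... | true  = ⊥-elim (true≢false (Reach.reach-complete adjA Bad s
                      (path-++ (Reach.reach-sound adjA Bad s c in-s)
                               (path-reverse symA t-good (Reach.reach-sound adjA Bad t c in-t))))
                      unreached)

      module Separated {u v : Fin nA} (u-good : Bad u ≡ false) (v-good : Bad v ≡ false)
                       (u↛v : component u v ≡ false) where

        C₁ C₂ : Fin nA → Bool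
        C₁ = component u
        C₂ = component v

        piece₁ : Piece C₁
        piece₁ = component-piece u-good

        piece₂ : Piece C₂
        piece₂ = component-piece v-good

        C₁-u : C₁ u ≡ true
        C₁-u = Reach.reach-start adjA Bad u

        C₂-v : C₂ v ≡ true
        C₂-v = Reach.reach-start adjA Bad v

        v↛u : C₂ u ≡ false
        v↛u = unreached-sym u-good v-good u↛v

        disjoint : ∀ c → C₁ c ≡ true → C₂ c ≡ false
        disjoint = components-disjoint v-good u↛v

        disjoint′ : ∀ c → C₂ c ≡ true → C₁ c ≡ false
        disjoint′ = components-disjoint u-good v↛u

        attached₁ : 4 ≤ attach C₁ a₁ + attach C₁ a₂
        attached₁ = attachments≥4 piece₁ C₁-u u↛v v-good

        attached₂ : 4 ≤ attach C₂ a₁ + attach C₂ a₂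
        attached₂ = attachments≥4 piece₂ C₂-v v↛u u-good

        -- A third component would need four more attachments, but a₁ and a₂ only have eight.
        cover : ∀ w → Bad w ≡ false → C₁ w ≡ true ⊎ C₂ w ≡ true
        cover w w-good with C₁ w in u→w | C₂ w in v→w
        ... | true  | _     = inj₁ refl
        ... | false | true  = inj₂ refl
        ... | false | false = ⊥-elim (<⇒≱ (≤ᵇ⇒≤ 9 12 _) (≤-trans twelve (+-mono-≤ (three≤4 a₁) (three≤4 a₂))))
          where
          C₃ = component w
          attached₃ : 4 ≤ attach C₃ a₁ + attach C₃ a₂
          attached₃ = attachments≥4 (component-piece w-good) (Reach.reach-start adjA Bad w)
                                    (unreached-sym u-good w-good u→w) u-good
          twelve : 12 ≤ (attach C₁ a₁ + (attach C₂ a₁ + attach C₃ a₁)) + (attach C₁ a₂ + (attach C₂ a₂ + attach C₃ a₂))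
          p : Fin nA → ℕ
          p a = attach C₂ a + attach C₃ a
          twelve = ≤-interchange (attach C₁ a₁) (attach C₁ a₂) (p a₁) (p a₂) attached₁
                     (≤-interchange (attach C₂ a₁) (attach C₂ a₂) (attach C₃ a₁) (attach C₃ a₂) attached₂ attached₃)
          three≤4 : ∀ a → attach C₁ a + (attach C₂ a + attach C₃ a) ≤ 4
          three≤4 a = ≤-trans (≤-reflexive (trans (cong (attach C₁ a +_) (attach-∨ a (components-disjoint w-good v→w)))
                                                  (attach-∨ a apart₁)))
                              (attach≤4 _ a)
            where
            apart₁ : ∀ c → C₁ c ≡ true → C₂ c ∨ C₃ c ≡ false
            apart₁ c in₁ = cong₂ _∨_ (disjoint c in₁) (components-disjoint w-good u→w c in₁)

        -- An edge a₁a₂ would use up one attachment at each end, leaving only six.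
        non-adjacent : adjA a₁ a₂ ≡ false
        non-adjacent with adjA a₁ a₂ in a₁~a₂
        ... | false = refl
        ... | true  = ⊥-elim (<⇒≱ (≤ᵇ⇒≤ 7 8 _)
            (≤-trans (≤-interchange (attach C₁ a₁) (attach C₁ a₂) (attach C₂ a₁) (attach C₂ a₂) attached₁ attached₂)
                     (+-mono-≤ (two≤3 (pair-inʳ a₁ a₂) a₁~a₂) (two≤3 (pair-inˡ a₁ a₂) (trans (symA a₂ a₁) a₁~a₂)))))
          where
          two≤3 : ∀ {a a′} → Bad a′ ≡ true → adjA a a′ ≡ true → attach C₁ a + attach C₂ a ≤ 3
          two≤3 {a} {a′} a′-bad a~a′ = ≤-pred (≤-trans (s≤s (≤-reflexive (attach-∨ a disjoint)))
            (≤-trans (count-strict (λ c e → proj₂ (∧-true {C₁ c ∨ C₂ c} e)) a′ a~a′ missing)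
                     (≤-reflexive (ClassA.regular A a))))
            where
            missing : (C₁ a′ ∨ C₂ a′) ∧ adjA a a′ ≡ false
            missing = cong (_∧ adjA a a′) (cong₂ _∨_ (outside-bad piece₁ {a′} a′-bad) (outside-bad piece₂ {a′} a′-bad))

        split-nbrs : ∀ {a} → Bad a ≡ true → ∀ c → adjA a c ≡ true → C₂ c ≡ not (C₁ c)
        split-nbrs {a} a-bad c a~c with cover c c-good
          where
          c-good : Bad c ≡ false
          c-good with Bad c in c-bad
          ... | false = refl
          ... | true with pair-true {a = a₁} {a₂} {a} a-bad | pair-true {a = a₁} {a₂} {c} c-bad
          ...   | inj₁ refl | inj₁ refl = ⊥-elim (adj⇒≢ a~c refl)
          ...   | inj₂ refl | inj₂ refl = ⊥-elim (adj⇒≢ a~c refl)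
          ...   | inj₁ refl | inj₂ refl = ⊥-elim (true≢false a~c non-adjacent)
          ...   | inj₂ refl | inj₁ refl = ⊥-elim (true≢false (trans (symA a₁ a₂) a~c) non-adjacent)
        ... | inj₁ in₁ rewrite in₁ = disjoint c in₁
        ... | inj₂ in₂ rewrite in₂ | disjoint′ c in₂ = refl

        sharp-sides : (TwoNbrsOneRed adjA colA a₁ C₁ × TwoNbrsOneRed adjA colA a₁ C₂)
                    ⊎ (TwoNbrsOneRed adjA colA a₂ C₁ × TwoNbrsOneRed adjA colA a₂ C₂)
        sharp-sides with sharp-or-through-port a₁ C₁ C₂ (split-nbrs (pair-inˡ a₁ a₂))
                       | sharp-or-through-port a₂ C₁ C₂ (split-nbrs (pair-inʳ a₁ a₂))
        ... | inj₁ sides₁        | _                 = inj₁ sides₁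
        ... | inj₂ _             | inj₁ sides₂        = inj₂ sides₂
        ... | inj₂ (q₁ , via₁) | inj₂ (q₂ , via₂) = ⊥-elim (both-through-ports via₁ via₂)
          where
          open CutAtPorts q₁ q₂
          both-through-ports : ThroughPort a₁ C₁ q₁ ⊎ ThroughPort a₁ C₂ q₁ →
                               ThroughPort a₂ C₁ q₂ ⊎ ThroughPort a₂ C₂ q₂ → ⊥
          both-through-ports (inj₁ m₁) (inj₁ m₂) = port-cut piece₁ m₁ m₂ C₁-u u↛v v-good
          both-through-ports (inj₂ m₁) (inj₂ m₂) = port-cut piece₂ m₁ m₂ C₂-v v↛u u-good
          both-through-ports (inj₁ m₁) (inj₂ m₂) =
            port-cut-mixed piece₁ piece₂ disjoint cover non-adjacent m₁ m₂ C₁-u C₂-v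
          both-through-ports (inj₂ m₁) (inj₁ m₂) =
            port-cut-mixed piece₂ piece₁ disjoint′ (λ c good → swap (cover c good)) non-adjacent m₁ m₂ C₂-v C₁-u

    forward : Sharp adjA colA × KConnected 2 adjA
    forward = sharp , A-2connected
      where
      sharp : Sharp adjA colA
      sharp a₁ a₂ a₁≢a₂ (u , v , u-good , v-good , separated) =
        C₁ , C₂ , Reach.reach-isComponent adjA Bad u symA u-good , Reach.reach-isComponent adjA Bad v symA v-good ,
        (u , C₁-u , v↛u) , cover , sharp-sides
        where
        open TwoCut a₁ a₂ a₁≢a₂
        u↛v : component u v ≡ false
        u↛v with component u v in reached
        ... | false = refl
        ... | true  = ⊥-elim (separated (Reach.reach-sound adjA Bad u v reached))
        open Separated u-good v-good u↛v

lemma6p4 : (r : ℕ) → 2 ≤ r → r ≤ 5 →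
    {nA nB : ℕ} (adjA : Adj nA) (colA : Fin nA → Colour)
    (adjB : Adj nB) (vtxB : Colour → Fin nB) (f : Fin nA → Fin nB) →
    ClassA adjA colA → ClassBStar r adjB vtxB →
    (∀ a → f a ≡ vtxB (colA a)) →
    (KConnected 3 (sierpinski adjA adjB f) ⇔ (Sharp adjA colA × KConnected 2 adjA))
lemma6p4 r 2≤r _ adjA colA adjB vtxB f A B* f-colour =
  mk⇔ (Connectivity.Forward.forward 2≤r A B* f-colour)
      (λ (sharp , A-2conn) → Connectivity.Backward.backward 2≤r A B* f-colour sharp A-2conn)
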